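{- Let $p$ be a predicate defined by the inductive pattern-based clauses $\{\forall\vec x_i.(\nabla\vec z_i.\,p\,\vec t_i)\stackrel{\mu}{=}B_i\,p\,\vec x_i\}_{i\in 1..n}$, interpreted in the logic $\mathcal{G}$ described below by the single translated clause $\forall\vec y.\ p\,\vec y\stackrel{\mu}{=}\bigvee_{i\in 1..n}\exists\vec x_i.\big(((\lambda\vec z_i.\,p'\,\vec t_i)\unrhd p'\,\vec y)\land B_i\,p\,\vec x_i\big)$, where $p'$ is a new constant with the same argument types as $p$ and the variables $\vec y$ do not occur in any $\vec t_i$. Then the following rule $\mathcal{IL}^p$ is admissible in $\mathcal{G}$ with this translated definition: from the premises $\{\vec x_i : B_i\,S\,\vec x_i\vdash\nabla\vec z_i.\,S\,\vec t_i\}_{i\in 1..n}$ and $\Sigma:\Gamma,S\,\vec s\vdash C$, infer $\Sigma:\Gamma,p\,\vec s\vdash C$, where $S$ is a term of the same type as $p$ containing no nominal constants.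
   Context: A pattern-based definition is a finite collection of clauses $\forall\vec x.(\nabla\vec z.\,p\,\vec t)\stackrel{\mu}{=}B\,p\,\vec x$ (all clauses of a given predicate annotated uniformly) where $\vec t$ are terms containing no nominal constants, $p\,\vec t$ has type $o$, and $B$ contains no occurrences of $p$, $\vec x$ or nominal constants with $B\,p\,\vec t$ of type $o$; several clauses may define the same $p$; stratified: $\mathrm{lvl}(B\,(\lambda\vec x.\top)\,\vec x)<\mathrm{lvl}(p)$ for every clause (levels as below). THE LOGIC $\mathcal{G}$. Terms are simply typed (Church) $\lambda$-terms over constants and variables, identified up to $\alpha\beta\eta$-conversion. There is a type $o$ of formulas; $o$ does not occur in argument types of non-logical constants nor in types of eigenvariables. Logical constants: $\top,\bot,\land,\lor,\supset$, and for each type $\tau$ not containing $o$, $\forall_\tau,\exists_\tau,\nabla_\tau$ of type $(\tau\to o)\to o$. Constants are partitioned into nominal constants $\mathcal{C}$ (infinitely many at each type at which $\nabla$ is allowed) and ordinary constants $\mathcal{K}$. $\mathrm{supp}(t)$ is the set of nominal constants in $t$. A permutation $\pi$ is a type-preserving bijection of $\mathcal{C}$ moving finitely many elements, acting on terms by renaming nominal constants; $B\approx B'$ iff $B$ $\lambda$-converts to $\pi.B'$ for some $\pi$. Substitutions: type-preserving maps from variables to terms, identity almost everywhere; $\mathrm{supp}(\theta)$ = nominal constants in the range. $B[\theta]$ is ordinary capture-avoiding application; $B\langle\theta\rangle=(\pi.B)[\theta]$ for a permutation $\pi$ sending $\mathrm{supp}(B)$ outside $\mathrm{supp}(\theta)$;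 $\Gamma\langle\theta\rangle=\{B\langle\theta\rangle\mid B\in\Gamma\}$. $\Sigma\theta$ is $\Sigma$ with the domain variables of $\theta$ removed and all free variables of the range terms added. Nominal abstraction: for $s:\tau_1\to\cdots\to\tau_n\to\tau$ and $t:\tau$, $s\unrhd t$ is a formula; "$s\unrhd t$ holds" iff $s$ $\lambda$-converts to $\lambda c_1\dots\lambda c_n.t$ (the $c_i$ distinct nominal constants abstracted out of $t$ by replacing them with fresh bound variables). $\theta$ is a solution to $s\unrhd t$ iff $(s\unrhd t)\langle\theta\rangle$ holds. Definitions of $\mathcal{G}$: a fixed finite set of clauses $\forall\vec x.\,p\,\vec x \triangleq B\,p\,\vec x$ (or $\stackrel{\mu}{=}$, inductive, or $\stackrel{\nu}{=}$, co-inductive), at most one per predicate constant $p$, where $B$ contains no $p$, no $\vec x$ and no nominal constants, and stratified: there are levels $\mathrm{lvl}(p)\in\mathbb{N}$, extended to $\lambda$-normal formulas by $\mathrm{lvl}(p\,\vec t)=\mathrm{lvl}(p)$, $\mathrm{lvl}(\top)=\mathrm{lvl}(\bot)=\mathrm{lvl}(s\unrhd t)=0$, $\mathrm{lvl}(B\land C)=\mathrm{lvl}(B\lor C)=\max$, $\mathrm{lvl}(B\supset C)=\max(\mathrm{lvl}(B)+1,\mathrm{lvl}(C))$, quantifiers transparent, with $\mathrm{lvl}(B\,(\lambda\vec x.\top)\,\vec x)<\mathrm{lvl}(p)$ for every clause. Sequents $\Sigma:\Gamma\vdash C$: $\Sigma$ a set of eigenvariables containing the free variables of $\Gamma,C$;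 $\Gamma$ a multiset. Rules: id: $\Sigma:\Gamma,B\vdash B'$ if $B\approx B'$. cut: from $\Sigma:\Gamma\vdash B$ and $\Sigma:B,\Delta\vdash C$ infer $\Sigma:\Gamma,\Delta\vdash C$. $c\mathcal{L}$: from $\Sigma:\Gamma,B,B\vdash C$ infer $\Sigma:\Gamma,B\vdash C$. $\bot\mathcal{L}$: $\Sigma:\Gamma,\bot\vdash C$. $\top\mathcal{R}$: $\Sigma:\Gamma\vdash\top$. $\lor\mathcal{L}$: from $\Sigma:\Gamma,B\vdash C$ and $\Sigma:\Gamma,D\vdash C$ infer $\Sigma:\Gamma,B\lor D\vdash C$. $\lor\mathcal{R}$: from $\Sigma:\Gamma\vdash B_i$ infer $\Sigma:\Gamma\vdash B_1\lor B_2$. $\land\mathcal{L}$: from $\Sigma:\Gamma,B_i\vdash C$ infer $\Sigma:\Gamma,B_1\land B_2\vdash C$. $\land\mathcal{R}$: from $\Sigma:\Gamma\vdash B$ and $\Sigma:\Gamma\vdash C$ infer $\Sigma:\Gamma\vdash B\land C$. $\supset\mathcal{L}$: from $\Sigma:\Gamma\vdash B$ and $\Sigma:\Gamma,D\vdash C$ infer $\Sigma:\Gamma,B\supset D\vdash C$. $\supset\mathcal{R}$: from $\Sigma:\Gamma,B\vdash C$ infer $\Sigma:\Gamma\vdash B\supset C$. $\forall\mathcal{L}$ / $\exists\mathcal{R}$: from $\Sigma:\Gamma,B[t/x]\vdash C$ (resp. $\Sigma:\Gamma\vdash B[t/x]$) infer $\Sigma:\Gamma,\forall_\tau x.B\vdash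 C$ (resp. $\Sigma:\Gamma\vdash\exists_\tau x.B$), where $t$ is a well-typed term of type $\tau$ built from $\Sigma$ and $\mathcal{K}\cup\mathcal{C}$. $\forall\mathcal{R}$ / $\exists\mathcal{L}$: from $\Sigma,h:\Gamma\vdash B[h\,\vec c/x]$ (resp. $\Sigma,h:\Gamma,B[h\,\vec c/x]\vdash C$) infer $\Sigma:\Gamma\vdash\forall x.B$ (resp. $\Sigma:\Gamma,\exists x.B\vdash C$), where $h\notin\Sigma$ is a fresh variable of suitable type and $\vec c$ lists $\mathrm{supp}(B)$. $\nabla\mathcal{L}$ / $\nabla\mathcal{R}$: from $\Sigma:\Gamma,B[a/x]\vdash C$ (resp. $\Sigma:\Gamma\vdash B[a/x]$) infer $\Sigma:\Gamma,\nabla x.B\vdash C$ (resp. $\Sigma:\Gamma\vdash\nabla x.B$), $a$ a nominal constant not in $\mathrm{supp}(B)$. $\unrhd\mathcal{L}$: from the (possibly infinite) family $\{\Sigma\theta:\Gamma\langle\theta\rangle\vdash C\langle\theta\rangle\mid\theta$ a solution to $s\unrhd t\}$ infer $\Sigma:\Gamma,s\unrhd t\vdash C$. $\unrhd\mathcal{R}$: $\Sigma:\Gamma\vdash s\unrhd t$ provided $s\unrhd t$ holds. $\mathit{def}\mathcal{L}$ / $\mathit{def}\mathcal{R}$ (for $p$ with clause body $B$ of any of the three kinds): from $\Sigma:\Gamma,B\,p\,\vec t\vdash C$ infer $\Sigma:\Gamma,p\,\vec t\vdash C$; from $\Sigma:\Gamma\vdash B\,p\,\vec t$ infer $\Sigma:\Gamma\vdash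 p\,\vec t$. $\mathcal{IL}$: if $p$ has clause $\forall\vec x.p\,\vec x\stackrel{\mu}{=}B\,p\,\vec x$ and $S$ is a term of the type of $p$ without nominal constants, from $\vec x:B\,S\,\vec x\vdash S\,\vec x$ and $\Sigma:\Gamma,S\,\vec t\vdash C$ infer $\Sigma:\Gamma,p\,\vec t\vdash C$. $\mathcal{CIR}$: if $p$ has clause $\forall\vec x.p\,\vec x\stackrel{\nu}{=}B\,p\,\vec x$ and $S$ as before, from $\Sigma:\Gamma\vdash S\,\vec t$ and $\vec x:S\,\vec x\vdash B\,S\,\vec x$ infer $\Sigma:\Gamma\vdash p\,\vec t$. Derivations are well-founded, possibly infinitely branching trees of rule instances. -}

module Defs where

open import Data.Nat using (ℕ; zero; suc; _<_; _⊔_)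
open import Data.List using (List; []; _∷_; _++_; map)
open import Data.List.Membership.Propositional using (_∈_)
open import Data.List.Relation.Unary.All using (All; []; _∷_)
open import Data.List.Relation.Unary.Unique.Propositional using (Unique)
open import Data.List.Relation.Binary.Permutation.Propositional using (_↭_)
open import Data.List.Relation.Binary.Pointwise using (Pointwise)
open import Data.Product using (Σ; _×_; _,_; ∃-syntax)
open import Data.Sum using (_⊎_)
open import Data.Empty using (⊥)
open import Data.Unit using (⊤)
open import Relation.Binary.PropositionalEquality using (_≡_; _≢_)
open import Relation.Nullary using (¬_)

-- types not containing o (eigenvariable types, quantifier types,
-- types of nominal constants)
data ITy : Set where
  ι    : ℕ → ITy
  _⇒ᵢ_ : ITy → ITy → ITy

infixr 30 _⇒ᵢ_ _⇒_

data Ty : Set where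
  ι   : ℕ → Ty
  o   : Ty
  _⇒_ : Ty → Ty → Ty

⌜_⌝ : ITy → Ty
⌜ ι n ⌝    = ι n
⌜ a ⇒ᵢ b ⌝ = ⌜ a ⌝ ⇒ ⌜ b ⌝

⌜_⌝ˢ : List ITy → List Ty
⌜ Σ' ⌝ˢ = map ⌜_⌝ Σ'

OFree : Ty → Set
OFree (ι _)   = ⊤
OFree o       = ⊥
OFree (a ⇒ b) = OFree a × OFree b

ArgsOFree : Ty → Set
ArgsOFree (a ⇒ b) = OFree a × ArgsOFree b
ArgsOFree _       = ⊤

_⇛_ : List ITy → Ty → Ty
[] ⇛ τ       = τ
(a ∷ as) ⇛ τ = ⌜ a ⌝ ⇒ (as ⇛ τ)

record Signature : Set₁ where
  field
    K      : Ty → Set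
    K-args : ∀ {τ} → K τ → ArgsOFree τ

-- nominal constants: infinitely many at each o-free type
Nom : Set
Nom = ITy × ℕ

module Logic (Sig : Signature) where
  open Signature Sig

  data LogC : Ty → Set where
    top bot      : LogC o
    and or imp   : LogC (o ⇒ o ⇒ o)
    all ex nab   : (a : ITy) → LogC ((⌜ a ⌝ ⇒ o) ⇒ o)
    -- nominal abstraction  s ⊵ t  for s : as ⇛ τ and t : τ
    nabs         : (as : List ITy) (τ : Ty) → LogC ((as ⇛ τ) ⇒ τ ⇒ o)

  data _∋_ : List Ty → Ty → Set where
    here  : ∀ {Γ τ} → (τ ∷ Γ) ∋ τ
    there : ∀ {Γ σ τ} → Γ ∋ τ → (σ ∷ Γ) ∋ τ

  -- intrinsically typed λ-terms (de Bruijn); free variables are the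
  -- eigenvariables, nominal constants are  nom a n
  data Tm (Γ : List Ty) : Ty → Set where
    var : ∀ {τ} → Γ ∋ τ → Tm Γ τ
    con : ∀ {τ} → K τ → Tm Γ τ
    nom : (a : ITy) → ℕ → Tm Γ ⌜ a ⌝
    lc  : ∀ {τ} → LogC τ → Tm Γ τ
    lam : ∀ {σ τ} → Tm (σ ∷ Γ) τ → Tm Γ (σ ⇒ τ)
    app : ∀ {σ τ} → Tm Γ (σ ⇒ τ) → Tm Γ σ → Tm Γ τ

  Ren : List Ty → List Ty → Set
  Ren Γ Δ = ∀ {τ} → Γ ∋ τ → Δ ∋ τ

  liftR : ∀ {Γ Δ σ} → Ren Γ Δ → Ren (σ ∷ Γ) (σ ∷ Δ)
  liftR ρ here      = here
  liftR ρ (there x) = there (ρ x)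

  rename : ∀ {Γ Δ τ} → Ren Γ Δ → Tm Γ τ → Tm Δ τ
  rename ρ (var x)   = var (ρ x)
  rename ρ (con k)   = con k
  rename ρ (nom a n) = nom a n
  rename ρ (lc c)    = lc c
  rename ρ (lam t)   = lam (rename (liftR ρ) t)
  rename ρ (app t u) = app (rename ρ t) (rename ρ u)

  wk : ∀ {Γ σ τ} → Tm Γ τ → Tm (σ ∷ Γ) τ
  wk = rename there

  Sub : List Ty → List Ty → Set
  Sub Γ Δ = ∀ {τ} → Γ ∋ τ → Tm Δ τ

  liftS : ∀ {Γ Δ σ} → Sub Γ Δ → Sub (σ ∷ Γ) (σ ∷ Δ)
  liftS θ here      = var here
  liftS θ (there x) = wk (θ x)

  subst : ∀ {Γ Δ τ} → Sub Γ Δ → Tm Γ τ → Tm Δ τ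
  subst θ (var x)   = θ x
  subst θ (con k)   = con k
  subst θ (nom a n) = nom a n
  subst θ (lc c)    = lc c
  subst θ (lam t)   = lam (subst (liftS θ) t)
  subst θ (app t u) = app (subst θ t) (subst θ u)

  sub₀ : ∀ {Γ σ} → Tm Γ σ → Sub (σ ∷ Γ) Γ
  sub₀ u here      = u
  sub₀ u (there x) = var x

  _[_]₀ : ∀ {Γ σ τ} → Tm (σ ∷ Γ) τ → Tm Γ σ → Tm Γ τ
  t [ u ]₀ = subst (sub₀ u) t

  wk₀ : ∀ {Γ τ} → Tm [] τ → Tm Γ τ
  wk₀ = rename (λ ())

  -- λαβη-conversion (α is built into de Bruijn syntax)
  infix 4 _≐_
  data _≐_ {Γ : List Ty} : ∀ {τ} → Tm Γ τ → Tm Γ τ → Set where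
    ≐refl  : ∀ {τ} {t : Tm Γ τ} → t ≐ t
    ≐sym   : ∀ {τ} {t u : Tm Γ τ} → t ≐ u → u ≐ t
    ≐trans : ∀ {τ} {t u v : Tm Γ τ} → t ≐ u → u ≐ v → t ≐ v
    ≐lam   : ∀ {σ τ} {t u : Tm (σ ∷ Γ) τ} → t ≐ u → lam t ≐ lam u
    ≐app   : ∀ {σ τ} {t t' : Tm Γ (σ ⇒ τ)} {u u' : Tm Γ σ} →
             t ≐ t' → u ≐ u' → app t u ≐ app t' u'
    ≐β     : ∀ {σ τ} (t : Tm (σ ∷ Γ) τ) (u : Tm Γ σ) → app (lam t) u ≐ t [ u ]₀
    ≐η     : ∀ {σ τ} (t : Tm Γ (σ ⇒ τ)) → t ≐ lam (app (wk t) (var here))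

  OccN : ∀ {Γ τ} → Nom → Tm Γ τ → Set
  OccN c (var _)   = ⊥
  OccN c (con _)   = ⊥
  OccN c (nom a n) = (a , n) ≡ c
  OccN c (lc _)    = ⊥
  OccN c (lam t)   = OccN c t
  OccN c (app t u) = OccN c t ⊎ OccN c u

  OccK : ∀ {Γ σ τ} → K σ → Tm Γ τ → Set
  OccK {σ = σ} k (con {τ} k') = _≡_ {A = Σ Ty K} (σ , k) (τ , k')
  OccK k (var _)   = ⊥
  OccK k (nom _ _) = ⊥
  OccK k (lc _)    = ⊥
  OccK k (lam t)   = OccK k t
  OccK k (app t u) = OccK k t ⊎ OccK k u

  -- since terms are identified up to conversion, a constant is in the
  -- support of t iff it occurs in every term convertible to t (i.e. in
  -- the normal form); t is free of c iff some convertible term lacks c.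
  InSupp : ∀ {Γ τ} → Nom → Tm Γ τ → Set
  InSupp c t = ∀ t' → t ≐ t' → OccN c t'

  Fresh : ∀ {Γ τ} → Nom → Tm Γ τ → Set
  Fresh c t = ∃[ t' ] (t ≐ t' × ¬ OccN c t')

  NomFree : ∀ {Γ τ} → Tm Γ τ → Set
  NomFree t = ∃[ t' ] (t ≐ t' × (∀ c → ¬ OccN c t'))

  KFree : ∀ {Γ σ τ} → K σ → Tm Γ τ → Set
  KFree k t = ∃[ t' ] (t ≐ t' × ¬ OccK k t')

  ListsSupp : ∀ {Γ τ} → List Nom → Tm Γ τ → Set
  ListsSupp cs t = Unique cs × (∀ c → c ∈ cs → InSupp c t)
                   × ∃[ t' ] (t ≐ t' × (∀ c → OccN c t' → c ∈ cs))

  record Perm : Set where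
    field
      fwd bwd : ITy → ℕ → ℕ
      left    : ∀ a n → bwd a (fwd a n) ≡ n
      right   : ∀ a n → fwd a (bwd a n) ≡ n
      finite  : ∃[ L ] (∀ a n → fwd a n ≢ n → (a , n) ∈ L)

  _·_ : ∀ {Γ τ} → Perm → Tm Γ τ → Tm Γ τ
  π · var x   = var x
  π · con k   = con k
  π · nom a n = nom a (Perm.fwd π a n)
  π · lc c    = lc c
  π · lam t   = lam (π · t)
  π · app t u = app (π · t) (π · u)

  permN : Perm → Nom → Nom
  permN π (a , n) = a , Perm.fwd π a n

  _≈_ : ∀ {Γ τ} → Tm Γ τ → Tm Γ τ → Set
  B ≈ B' = ∃[ π ] (B ≐ π · B')

  -- ext as Γ : Γ extended by bound variables for a₁ … aₙ (a₁ outermost)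
  ext : List ITy → List Ty → List Ty
  ext [] Γ       = Γ
  ext (a ∷ as) Γ = ext as (⌜ a ⌝ ∷ Γ)

  extI : List ITy → List ITy → List ITy
  extI [] Σ'       = Σ'
  extI (a ∷ as) Σ' = extI as (a ∷ Σ')

  toExt : ∀ as Σ' → Ren (ext as ⌜ Σ' ⌝ˢ) ⌜ extI as Σ' ⌝ˢ
  toExt [] Σ' x       = x
  toExt (a ∷ as) Σ' x = toExt as (a ∷ Σ') x

  extWk : ∀ as {Γ} → Ren Γ (ext as Γ)
  extWk [] x       = x
  extWk (a ∷ as) x = extWk as (there x)

  liftExt : ∀ as {Γ Δ} → Ren Γ Δ → Ren (ext as Γ) (ext as Δ)
  liftExt [] ρ       = ρ
  liftExt (a ∷ as) ρ = liftExt as (liftR ρ)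

  lams : ∀ as {Γ τ} → Tm (ext as Γ) τ → Tm Γ (as ⇛ τ)
  lams [] t       = t
  lams (a ∷ as) t = lam (lams as t)

  TmArgs : List Ty → List ITy → Set
  TmArgs Γ as = All (λ a → Tm Γ ⌜ a ⌝) as

  renameArgs : ∀ {Γ Δ as} → Ren Γ Δ → TmArgs Γ as → TmArgs Δ as
  renameArgs ρ []       = []
  renameArgs ρ (t ∷ ts) = rename ρ t ∷ renameArgs ρ ts

  apps : ∀ {Γ as τ} → Tm Γ (as ⇛ τ) → TmArgs Γ as → Tm Γ τ
  apps f []       = f
  apps f (t ∷ ts) = apps (app f t) ts

  extVars : ∀ as Γ → TmArgs (ext as Γ) as
  extVars [] Γ       = []
  extVars (a ∷ as) Γ = rename (extWk as) (var here) ∷ extVars as (⌜ a ⌝ ∷ Γ)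

  ArgsNomFree : ∀ {Γ as} → TmArgs Γ as → Set
  ArgsNomFree []       = ⊤
  ArgsNomFree (t ∷ ts) = NomFree t × ArgsNomFree ts

  ArgsKFree : ∀ {Γ as σ} → K σ → TmArgs Γ as → Set
  ArgsKFree k []       = ⊤
  ArgsKFree k (t ∷ ts) = KFree k t × ArgsKFree k ts

  noms : ∀ as → All (λ _ → ℕ) as → List Nom
  noms [] []             = []
  noms (a ∷ as) (n ∷ ns) = (a , n) ∷ noms as ns

  inst : ∀ as {Γ τ} → All (λ _ → ℕ) as → Tm (ext as Γ) τ → Tm Γ τ
  inst [] [] t             = t
  inst (a ∷ as) (n ∷ ns) t = inst as ns t [ nom a n ]₀

  -- type and application of the raised eigenvariable  h c₁ … cₙ
  hTy : List Nom → ITy → ITy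
  hTy [] a             = a
  hTy ((b , _) ∷ cs) a = b ⇒ᵢ hTy cs a

  hApp : ∀ {Γ} cs {a} → Tm Γ ⌜ hTy cs a ⌝ → Tm Γ ⌜ a ⌝
  hApp [] f             = f
  hApp ((b , n) ∷ cs) f = hApp cs (app f (nom b n))

  ⊤̇ ⊥̇ : ∀ {Γ} → Tm Γ o
  ⊤̇ = lc top
  ⊥̇ = lc bot

  infixr 6 _∧̇_
  infixr 5 _∨̇_
  infixr 4 _⊃̇_
  _∧̇_ _∨̇_ _⊃̇_ : ∀ {Γ} → Tm Γ o → Tm Γ o → Tm Γ o
  A ∧̇ B = app (app (lc and) A) B
  A ∨̇ B = app (app (lc or) A) B
  A ⊃̇ B = app (app (lc imp) A) B

  ∀̇ ∃̇ ∇̇ : ∀ {Γ} (a : ITy) → Tm Γ (⌜ a ⌝ ⇒ o) → Tm Γ o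
  ∀̇ a P = app (lc (all a)) P
  ∃̇ a P = app (lc (ex a)) P
  ∇̇ a P = app (lc (nab a)) P

  _⊵_ : ∀ {Γ as τ} → Tm Γ (as ⇛ τ) → Tm Γ τ → Tm Γ o
  _⊵_ {as = as} {τ} s t = app (app (lc (nabs as τ)) s) t

  ∃* ∇* : ∀ as {Γ} → Tm (ext as Γ) o → Tm Γ o
  ∃* [] F       = F
  ∃* (a ∷ as) F = ∃̇ a (lam (∃* as F))
  ∇* [] F       = F
  ∇* (a ∷ as) F = ∇̇ a (lam (∇* as F))

  ⋁ : ∀ {Γ} → List (Tm Γ o) → Tm Γ o
  ⋁ []           = ⊥̇
  ⋁ (F ∷ [])     = F
  ⋁ (F ∷ G ∷ Fs) = F ∨̇ ⋁ (G ∷ Fs)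

  -- Nominal abstraction:  s ⊵ t  holds iff s converts to λc₁…cₙ.t, i.e.
  -- there are distinct c⃗ and t' free of c⃗ with t = t'[c⃗/x⃗], s = λx⃗.t'

  Holds : ∀ {Γ} as {τ} → Tm Γ (as ⇛ τ) → Tm Γ τ → Set
  Holds {Γ} as {τ} s t =
    ∃[ ns ] (Unique (noms as ns) ×
      ∃[ t' ] ((∀ c → c ∈ noms as ns → ¬ OccN {ext as Γ} {τ} c t')
               × s ≐ lams as t' × t ≐ inst as ns t'))

  data Hd : Set where
    hLog   : Σ Ty LogC → Hd
    hCon   : ℕ → Hd
    hOther : Hd

  combine : Hd → List ℕ → ℕ
  combine (hLog (_ , imp)) (A ∷ B ∷ [])   = suc A ⊔ B
  combine (hLog (_ , and)) (A ∷ B ∷ [])   = A ⊔ B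
  combine (hLog (_ , or)) (A ∷ B ∷ [])    = A ⊔ B
  combine (hLog (_ , all _)) (P ∷ [])     = P
  combine (hLog (_ , ex _)) (P ∷ [])      = P
  combine (hLog (_ , nab _)) (P ∷ [])     = P
  combine (hCon l) _                      = l
  combine _ _                             = 0

  module _ (lv : ∀ {τ} → K τ → ℕ) where
    hd : ∀ {Γ τ} → Tm Γ τ → Hd
    hd (app f _) = hd f
    hd (con k)   = hCon (lv k)
    hd (lc c)    = hLog (_ , c)
    hd _         = hOther

    lvl : ∀ {Γ τ} → Tm Γ τ → ℕ
    spineLvls : ∀ {Γ τ} → Tm Γ τ → List ℕ
    lvl (lam t)   = lvl t
    lvl (app f a) = combine (hd (app f a)) (spineLvls (app f a))
    lvl (var x)   = 0
    lvl (con k)   = lv k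
    lvl (nom a n) = 0
    lvl (lc c)    = 0
    spineLvls (app f a) = spineLvls f ++ (lvl a ∷ [])
    spineLvls _         = []

  NotLam : ∀ {Γ τ} → Tm Γ τ → Set
  NotLam (lam _) = ⊥
  NotLam _       = ⊤

  Normal : ∀ {Γ τ} → Tm Γ τ → Set
  Normal (lam t)   = Normal t
  Normal (app f a) = NotLam f × Normal f × Normal a
  Normal _         = ⊤

  LvlBelow : (lv : ∀ {τ} → K τ → ℕ) → ∀ {Γ} → Tm Γ o → ℕ → Set
  LvlBelow lv {Γ} F n = ∀ (N : Tm Γ o) → Normal N → F ≐ N → lvl lv N < n

  data Kind : Set where
    plain ind coind : Kind

  -- ∀x⃗. p x⃗ ≜ body p x⃗   (≜, μ= or ν= according to kind)
  record Clause : Set where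
    constructor clause
    field
      args : List ITy
      pred : K (args ⇛ o)
      kind : Kind
      body : Tm [] ((args ⇛ o) ⇒ (args ⇛ o))

  open Clause public

  bodyTop : (c : Clause) → Tm (ext (args c) []) o
  bodyTop c = apps (app (wk₀ (body c)) (lams (args c) ⊤̇)) (extVars (args c) [])

  record WFDefs (D : List Clause) (lv : ∀ {τ} → K τ → ℕ) : Set where
    field
      onePer  : ∀ {c c'} → c ∈ D → c' ∈ D →
                _≡_ {A = Σ (List ITy) (λ as → K (as ⇛ o))} (args c , pred c) (args c' , pred c') →
                c ≡ c'
      noPred  : ∀ {c} → c ∈ D → KFree (pred c) (body c)
      noNoms  : ∀ {c} → c ∈ D → NomFree (body c)
      strat   : ∀ {c} → c ∈ D → LvlBelow lv (bodyTop c) (lv (pred c))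

  Form : List ITy → Set
  Form Σ' = Tm ⌜ Σ' ⌝ˢ o

  ESub : List ITy → List ITy → Set
  ESub Σ₁ Σ₂ = Sub ⌜ Σ₁ ⌝ˢ ⌜ Σ₂ ⌝ˢ

  Admissible : ∀ {Σ₁ Σ₂ τ} → Perm → ESub Σ₁ Σ₂ → Tm ⌜ Σ₁ ⌝ˢ τ → Set
  Admissible {Σ₁} π θ B =
    ∀ c → InSupp c B → ∀ {σ} (x : ⌜ Σ₁ ⌝ˢ ∋ σ) → Fresh (permN π c) (θ x)

  Raise : ∀ {Σ₁ Σ₂ τ} → ESub Σ₁ Σ₂ → Tm ⌜ Σ₁ ⌝ˢ τ → Tm ⌜ Σ₂ ⌝ˢ τ → Set
  Raise θ B B' = ∃[ π ] (Admissible π θ B × B' ≡ subst θ (π · B))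

  Solution : ∀ {Σ₁ Σ₂ as τ} → ESub Σ₁ Σ₂ →
             Tm ⌜ Σ₁ ⌝ˢ (as ⇛ τ) → Tm ⌜ Σ₁ ⌝ˢ τ → Set
  Solution {as = as} θ s t =
    ∃[ π ] (Admissible π θ (s ⊵ t) × Holds as (subst θ (π · s)) (subst θ (π · t)))

  pApp : ∀ {Γ} (c : Clause) → TmArgs Γ (args c) → Tm Γ o
  pApp c ts = apps (con (pred c)) ts

  bApp : ∀ {Γ} (c : Clause) → Tm Γ (args c ⇛ o) → TmArgs Γ (args c) → Tm Γ o
  bApp c q ts = apps (app (wk₀ (body c)) q) ts

  xCtx : List ITy → List ITy
  xCtx as = extI as []

  xVars : ∀ as → TmArgs ⌜ xCtx as ⌝ˢ as
  xVars as = renameArgs (toExt as []) (extVars as [])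

  wkF : ∀ {Σ' h} → Form Σ' → Form (h ∷ Σ')
  wkF = wk

  data Seq (D : List Clause) : (Σ' : List ITy) → List (Form Σ') → Form Σ' → Set where
    -- structural: Γ is a multiset, formulas are taken up to λ-conversion
    exch : ∀ {Σ' Γ Γ' C} → Γ ↭ Γ' → Seq D Σ' Γ' C → Seq D Σ' Γ C
    conv : ∀ {Σ' Γ Γ' C C'} → Pointwise _≐_ Γ Γ' → C ≐ C' →
           Seq D Σ' Γ' C' → Seq D Σ' Γ C
    id   : ∀ {Σ' Γ B B'} → B ≈ B' → Seq D Σ' (B ∷ Γ) B'
    cut  : ∀ {Σ' Γ Δ B C} → Seq D Σ' Γ B → Seq D Σ' (B ∷ Δ) C → Seq D Σ' (Γ ++ Δ) C
    cL   : ∀ {Σ' Γ B C} → Seq D Σ' (B ∷ B ∷ Γ) C → Seq D Σ' (B ∷ Γ) C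
    ⊥L   : ∀ {Σ' Γ C} → Seq D Σ' (⊥̇ ∷ Γ) C
    ⊤R   : ∀ {Σ' Γ} → Seq D Σ' Γ ⊤̇
    ∨L   : ∀ {Σ' Γ B B' C} → Seq D Σ' (B ∷ Γ) C → Seq D Σ' (B' ∷ Γ) C →
           Seq D Σ' ((B ∨̇ B') ∷ Γ) C
    ∨R₁  : ∀ {Σ' Γ B B'} → Seq D Σ' Γ B → Seq D Σ' Γ (B ∨̇ B')
    ∨R₂  : ∀ {Σ' Γ B B'} → Seq D Σ' Γ B' → Seq D Σ' Γ (B ∨̇ B')
    ∧L₁  : ∀ {Σ' Γ B B' C} → Seq D Σ' (B ∷ Γ) C → Seq D Σ' ((B ∧̇ B') ∷ Γ) C
    ∧L₂  : ∀ {Σ' Γ B B' C} → Seq D Σ' (B' ∷ Γ) C → Seq D Σ' ((B ∧̇ B') ∷ Γ) C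
    ∧R   : ∀ {Σ' Γ B C} → Seq D Σ' Γ B → Seq D Σ' Γ C → Seq D Σ' Γ (B ∧̇ C)
    ⊃L   : ∀ {Σ' Γ B B' C} → Seq D Σ' Γ B → Seq D Σ' (B' ∷ Γ) C →
           Seq D Σ' ((B ⊃̇ B') ∷ Γ) C
    ⊃R   : ∀ {Σ' Γ B C} → Seq D Σ' (B ∷ Γ) C → Seq D Σ' Γ (B ⊃̇ C)
    -- ∀x.B is ∀̇ a P with P = λx.B, so B[t/x] is (up to conversion) P t
    ∀L   : ∀ {Σ' Γ a P C} (t : Tm ⌜ Σ' ⌝ˢ ⌜ a ⌝) →
           Seq D Σ' (app P t ∷ Γ) C → Seq D Σ' (∀̇ a P ∷ Γ) C
    ∃R   : ∀ {Σ' Γ a P} (t : Tm ⌜ Σ' ⌝ˢ ⌜ a ⌝) →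
           Seq D Σ' Γ (app P t) → Seq D Σ' Γ (∃̇ a P)
    ∀R   : ∀ {Σ' Γ a P} (cs : List Nom) → ListsSupp cs P →
           Seq D (hTy cs a ∷ Σ') (map wkF Γ) (app (wk P) (hApp cs (var here))) →
           Seq D Σ' Γ (∀̇ a P)
    ∃L   : ∀ {Σ' Γ a P C} (cs : List Nom) → ListsSupp cs P →
           Seq D (hTy cs a ∷ Σ') (app (wk P) (hApp cs (var here)) ∷ map wkF Γ) (wkF C) →
           Seq D Σ' (∃̇ a P ∷ Γ) C
    ∇L   : ∀ {Σ' Γ a P C} (n : ℕ) → Fresh (a , n) P →
           Seq D Σ' (app P (nom a n) ∷ Γ) C → Seq D Σ' (∇̇ a P ∷ Γ) C
    ∇R   : ∀ {Σ' Γ a P} (n : ℕ) → Fresh (a , n) P →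
           Seq D Σ' Γ (app P (nom a n)) → Seq D Σ' Γ (∇̇ a P)
    ⊵L   : ∀ {Σ' Γ C as τ} {s : Tm ⌜ Σ' ⌝ˢ (as ⇛ τ)} {t : Tm ⌜ Σ' ⌝ˢ τ} →
           (∀ Σ'' (θ : ESub Σ' Σ'') → Solution θ s t →
              ∀ Γ' C' → Pointwise (Raise θ) Γ Γ' → Raise θ C C' →
              Seq D Σ'' Γ' C') →
           Seq D Σ' ((s ⊵ t) ∷ Γ) C
    ⊵R   : ∀ {Σ' Γ as τ} {s : Tm ⌜ Σ' ⌝ˢ (as ⇛ τ)} {t : Tm ⌜ Σ' ⌝ˢ τ} →
           Holds as s t → Seq D Σ' Γ (s ⊵ t)
    defL : ∀ {Σ' Γ C} (c : Clause) → c ∈ D → (ts : TmArgs ⌜ Σ' ⌝ˢ (args c)) →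
           Seq D Σ' (bApp c (con (pred c)) ts ∷ Γ) C → Seq D Σ' (pApp c ts ∷ Γ) C
    defR : ∀ {Σ' Γ} (c : Clause) → c ∈ D → (ts : TmArgs ⌜ Σ' ⌝ˢ (args c)) →
           Seq D Σ' Γ (bApp c (con (pred c)) ts) → Seq D Σ' Γ (pApp c ts)
    IL   : ∀ {Σ' Γ C} (c : Clause) → c ∈ D → kind c ≡ ind →
           (S : Tm [] (args c ⇛ o)) → NomFree S → (ts : TmArgs ⌜ Σ' ⌝ˢ (args c)) →
           Seq D (xCtx (args c)) (bApp c (wk₀ S) (xVars (args c)) ∷ [])
                 (apps (wk₀ S) (xVars (args c))) →
           Seq D Σ' (apps (wk₀ S) ts ∷ Γ) C →
           Seq D Σ' (pApp c ts ∷ Γ) C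
    CIR  : ∀ {Σ' Γ} (c : Clause) → c ∈ D → kind c ≡ coind →
           (S : Tm [] (args c ⇛ o)) → NomFree S → (ts : TmArgs ⌜ Σ' ⌝ˢ (args c)) →
           Seq D Σ' Γ (apps (wk₀ S) ts) →
           Seq D (xCtx (args c)) (apps (wk₀ S) (xVars (args c)) ∷ [])
                 (bApp c (wk₀ S) (xVars (args c))) →
           Seq D Σ' Γ (pApp c ts)

  -- Pattern-based inductive clauses  ∀x⃗.(∇z⃗. p t⃗) μ= B p x⃗
  -- for a predicate with argument types pargs

  record PClause (pargs : List ITy) : Set where
    constructor pclause
    field
      xs : List ITy
      zs : List ITy
      ts : TmArgs (ext zs (ext xs [])) pargs
      B  : Tm [] ((pargs ⇛ o) ⇒ (xs ⇛ o))

  open PClause public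

  record PClauseOK {pargs} (lv : ∀ {τ} → K τ → ℕ) (p : K (pargs ⇛ o))
                   (pc : PClause pargs) : Set where
    field
      tsNoNoms : ArgsNomFree (ts pc)
      BnoPred  : KFree p (B pc)
      BnoNoms  : NomFree (B pc)
      strat    : LvlBelow lv
                   (apps (app (wk₀ (B pc)) (lams pargs ⊤̇)) (extVars (xs pc) []))
                   (lv p)

  -- the disjunct  ∃x⃗.((λz⃗. p' t⃗) ⊵ p' y⃗) ∧ B P x⃗   in context  P, y⃗
  transDisj : ∀ {pargs} → K (pargs ⇛ o) → PClause pargs →
              Tm (ext pargs ((pargs ⇛ o) ∷ [])) o
  transDisj {pargs} p' (pclause xs zs ts B) =
    ∃* xs (((lams zs (apps (con p')
                        (renameArgs (liftExt zs (liftExt xs (λ ()))) ts)))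
             ⊵ apps (con p') (renameArgs (extWk xs) (extVars pargs ((pargs ⇛ o) ∷ []))))
           ∧̇ apps (app (wk₀ B) (rename (extWk xs) (rename (extWk pargs) (var here))))
                  (extVars xs (ext pargs ((pargs ⇛ o) ∷ []))))

  translate : ∀ {pargs} → K (pargs ⇛ o) → K (pargs ⇛ o) → List (PClause pargs) → Clause
  translate {pargs} p p' pcs =
    clause pargs p ind (lam (lams pargs (⋁ (map (transDisj p') pcs))))

  ILpPremise : ∀ {pargs} → List Clause → Tm [] (pargs ⇛ o) → PClause pargs → Set
  ILpPremise D S (pclause xs zs ts B) =
    Seq D (xCtx xs)
      (apps (app (wk₀ B) (wk₀ S)) (xVars xs) ∷ [])
      (∇* zs (apps (wk₀ S) (renameArgs (liftExt zs (toExt xs [])) ts)))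

-- Apply the induction rule IL of G to the translated clause with the invariant S itself.  Its
-- premise is a disjunction over the pattern clauses; in case i, after ∃L and ⊵L, every solution
-- of (λz⃗. p' t⃗ᵢ) ⊵ p' y⃗ has to be treated, and there the premise of IL^p, instantiated at the
-- solution, gives ∇z⃗. S t⃗ᵢ, whose ∇L-instance converts to S y⃗.  That last conversion is the
-- delicate point: λβη-conversion is not syntactic, so p' t⃗ ≐ p' u⃗ does not directly yield
-- S t⃗ ≐ S u⃗.  It does after replacing every constant of the type of p' by S, a map that
-- preserves conversion and, by weak normalisation, fixes every term of an o-free type up to
-- conversion (a normal term of o-free type cannot contain such a constant, since constants only
-- take o-free arguments).
module Submission where

open import Axiom.UniquenessOfIdentityProofs using (module Decidable⇒UIP)
open import Data.Empty using (⊥; ⊥-elim)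
open import Data.List using (List; []; _∷_; map)
open import Data.List.Membership.Propositional using (_∈_)
open import Data.List.Membership.Propositional.Properties using (∈-map⁻)
open import Data.List.Properties using (map-++)
open import Data.List.Relation.Binary.Permutation.Propositional using (↭-refl; swap)
import Data.List.Relation.Binary.Permutation.Propositional.Properties as ↭
open import Data.List.Relation.Binary.Pointwise using (Pointwise; []; _∷_)
open import Data.List.Relation.Unary.All as All using (All; []; _∷_)
open import Data.List.Relation.Unary.AllPairs using ([]; _∷_)
open import Data.List.Relation.Unary.Any using (here; there)
open import Data.List.Relation.Unary.Unique.Propositional using (Unique)
open import Data.Nat using (ℕ; suc)
open import Data.Nat.Properties using (1+n≢n; _≟_)
open import Data.Product using (Σ; _×_; _,_; ∃-syntax; proj₁; proj₂)
open import Data.Sum using (_⊎_; inj₁; inj₂; [_,_]; map₁)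
open import Data.Unit using (⊤; tt)
open import Function using (_∘_)
open import Relation.Binary.PropositionalEquality
  using (_≡_; _≢_; refl; sym; trans; cong; cong₂) renaming (subst to transport)
open import Relation.Binary.Bundles using (Setoid)
import Relation.Binary.Reasoning.Setoid as SetoidReasoning
open import Relation.Nullary using (Dec; yes; no; ¬_)

open import Defs

_≟ᵀ_ : (σ τ : Ty) → Dec (σ ≡ τ)
ι n ≟ᵀ ι m with n ≟ m
... | yes refl = yes refl
... | no n≢m   = no λ { refl → n≢m refl }
ι _ ≟ᵀ o       = no λ ()
ι _ ≟ᵀ (_ ⇒ _) = no λ ()
o ≟ᵀ ι _       = no λ ()
o ≟ᵀ o         = yes refl
o ≟ᵀ (_ ⇒ _)   = no λ ()
(_ ⇒ _) ≟ᵀ ι _ = no λ ()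
(_ ⇒ _) ≟ᵀ o   = no λ ()
(σ ⇒ τ) ≟ᵀ (σ' ⇒ τ') with σ ≟ᵀ σ' | τ ≟ᵀ τ'
... | yes refl | yes refl = yes refl
... | no σ≢σ'  | _        = no λ { refl → σ≢σ' refl }
... | yes _    | no τ≢τ'  = no λ { refl → τ≢τ' refl }

OFree-⌜⌝ : ∀ a → OFree ⌜ a ⌝
OFree-⌜⌝ (ι n)    = tt
OFree-⌜⌝ (a ⇒ᵢ b) = OFree-⌜⌝ a , OFree-⌜⌝ b

OFree⇒ArgsOFree : ∀ τ → OFree τ → ArgsOFree τ
OFree⇒ArgsOFree (ι n)   _        = tt
OFree⇒ArgsOFree (σ ⇒ τ) (oσ , oτ) = oσ , OFree⇒ArgsOFree τ oτ

EndsInO : Ty → Set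
EndsInO (ι _)   = ⊥
EndsInO o       = ⊤
EndsInO (_ ⇒ τ) = EndsInO τ

EndsInO⇒¬OFree : ∀ τ → EndsInO τ → ¬ OFree τ
EndsInO⇒¬OFree o       _ f       = f
EndsInO⇒¬OFree (_ ⇒ τ) e (_ , f) = EndsInO⇒¬OFree τ e f

⇛o-¬OFree : ∀ as → ¬ OFree (as ⇛ o)
⇛o-¬OFree []       f       = f
⇛o-¬OFree (_ ∷ as) (_ , f) = ⇛o-¬OFree as f

module _ (Sig : Signature) where
  open Signature Sig
  open Logic Sig

  _≗ʳ_ : ∀ {Γ Δ} → Ren Γ Δ → Ren Γ Δ → Set
  ρ ≗ʳ ρ' = ∀ {τ} (x : _ ∋ τ) → ρ x ≡ ρ' x

  _≗ˢ_ : ∀ {Γ Δ} → Sub Γ Δ → Sub Γ Δ → Set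
  θ ≗ˢ θ' = ∀ {τ} (x : _ ∋ τ) → θ x ≡ θ' x

  liftR-cong : ∀ {Γ Δ σ} {ρ ρ' : Ren Γ Δ} → ρ ≗ʳ ρ' → liftR {σ = σ} ρ ≗ʳ liftR ρ'
  liftR-cong e here      = refl
  liftR-cong e (there x) = cong there (e x)

  rename-cong : ∀ {Γ Δ τ} {ρ ρ' : Ren Γ Δ} → ρ ≗ʳ ρ' → (t : Tm Γ τ) → rename ρ t ≡ rename ρ' t
  rename-cong e (var x)   = cong var (e x)
  rename-cong e (con k)   = refl
  rename-cong e (nom a n) = refl
  rename-cong e (lc c)    = refl
  rename-cong e (lam t)   = cong lam (rename-cong (liftR-cong e) t)
  rename-cong e (app t u) = cong₂ app (rename-cong e t) (rename-cong e u)

  rename-∘ : ∀ {Γ Δ Ε τ} (ρ : Ren Δ Ε) (ρ' : Ren Γ Δ) (t : Tm Γ τ) →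
             rename ρ (rename ρ' t) ≡ rename (ρ ∘ ρ') t
  rename-∘ ρ ρ' (var x)   = refl
  rename-∘ ρ ρ' (con k)   = refl
  rename-∘ ρ ρ' (nom a n) = refl
  rename-∘ ρ ρ' (lc c)    = refl
  rename-∘ ρ ρ' (lam t)   =
    cong lam (trans (rename-∘ (liftR ρ) (liftR ρ') t)
                    (rename-cong (λ { here → refl ; (there x) → refl }) t))
  rename-∘ ρ ρ' (app t u) = cong₂ app (rename-∘ ρ ρ' t) (rename-∘ ρ ρ' u)

  rename-id : ∀ {Γ τ} (t : Tm Γ τ) → rename (λ x → x) t ≡ t
  rename-id (var x)   = refl
  rename-id (con k)   = refl
  rename-id (nom a n) = refl
  rename-id (lc c)    = refl
  rename-id (lam t)   = cong lam (trans (rename-cong (λ { here → refl ; (there x) → refl }) t)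
                                        (rename-id t))
  rename-id (app t u) = cong₂ app (rename-id t) (rename-id u)

  liftS-cong : ∀ {Γ Δ σ} {θ θ' : Sub Γ Δ} → θ ≗ˢ θ' → liftS {σ = σ} θ ≗ˢ liftS θ'
  liftS-cong e here      = refl
  liftS-cong e (there x) = cong wk (e x)

  subst-cong : ∀ {Γ Δ τ} {θ θ' : Sub Γ Δ} → θ ≗ˢ θ' → (t : Tm Γ τ) → subst θ t ≡ subst θ' t
  subst-cong e (var x)   = e x
  subst-cong e (con k)   = refl
  subst-cong e (nom a n) = refl
  subst-cong e (lc c)    = refl
  subst-cong e (lam t)   = cong lam (subst-cong (liftS-cong e) t)
  subst-cong e (app t u) = cong₂ app (subst-cong e t) (subst-cong e u)

  subst-rename : ∀ {Γ Δ Ε τ} (θ : Sub Δ Ε) (ρ : Ren Γ Δ) (t : Tm Γ τ) →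
                 subst θ (rename ρ t) ≡ subst (θ ∘ ρ) t
  subst-rename θ ρ (var x)   = refl
  subst-rename θ ρ (con k)   = refl
  subst-rename θ ρ (nom a n) = refl
  subst-rename θ ρ (lc c)    = refl
  subst-rename θ ρ (lam t)   =
    cong lam (trans (subst-rename (liftS θ) (liftR ρ) t)
                    (subst-cong (λ { here → refl ; (there x) → refl }) t))
  subst-rename θ ρ (app t u) = cong₂ app (subst-rename θ ρ t) (subst-rename θ ρ u)

  rename-subst : ∀ {Γ Δ Ε τ} (ρ : Ren Δ Ε) (θ : Sub Γ Δ) (t : Tm Γ τ) →
                 rename ρ (subst θ t) ≡ subst (rename ρ ∘ θ) t
  rename-subst ρ θ (var x)   = refl
  rename-subst ρ θ (con k)   = refl
  rename-subst ρ θ (nom a n) = refl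
  rename-subst ρ θ (lc c)    = refl
  rename-subst ρ θ (lam t)   =
    cong lam (trans (rename-subst (liftR ρ) (liftS θ) t)
                    (subst-cong (λ { here → refl
                                   ; (there x) → trans (rename-∘ (liftR ρ) there (θ x))
                                                       (sym (rename-∘ there ρ (θ x))) }) t))
  rename-subst ρ θ (app t u) = cong₂ app (rename-subst ρ θ t) (rename-subst ρ θ u)

  subst-subst : ∀ {Γ Δ Ε τ} (θ : Sub Δ Ε) (θ' : Sub Γ Δ) (t : Tm Γ τ) →
                subst θ (subst θ' t) ≡ subst (subst θ ∘ θ') t
  subst-subst θ θ' (var x)   = refl
  subst-subst θ θ' (con k)   = refl
  subst-subst θ θ' (nom a n) = refl
  subst-subst θ θ' (lc c)    = refl
  subst-subst θ θ' (lam t)   =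
    cong lam (trans (subst-subst (liftS θ) (liftS θ') t)
                    (subst-cong (λ { here → refl
                                   ; (there x) → trans (subst-rename (liftS θ) there (θ' x))
                                                       (sym (rename-subst there θ (θ' x))) }) t))
  subst-subst θ θ' (app t u) = cong₂ app (subst-subst θ θ' t) (subst-subst θ θ' u)

  subst-var : ∀ {Γ τ} (t : Tm Γ τ) → subst var t ≡ t
  subst-var (var x)   = refl
  subst-var (con k)   = refl
  subst-var (nom a n) = refl
  subst-var (lc c)    = refl
  subst-var (lam t)   = cong lam (trans (subst-cong (λ { here → refl ; (there x) → refl }) t)
                                        (subst-var t))
  subst-var (app t u) = cong₂ app (subst-var t) (subst-var u)

  rename-as-subst : ∀ {Γ Δ τ} (ρ : Ren Γ Δ) (t : Tm Γ τ) → rename ρ t ≡ subst (var ∘ ρ) t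
  rename-as-subst ρ t = trans (sym (subst-var (rename ρ t))) (subst-rename var ρ t)

  subst-wk : ∀ {Γ Δ σ τ} (θ : Sub Γ Δ) (t : Tm Γ τ) →
             subst (liftS {σ = σ} θ) (wk t) ≡ wk (subst θ t)
  subst-wk θ t = trans (subst-rename (liftS θ) there t) (sym (rename-subst there θ t))

  rename-wk : ∀ {Γ Δ σ τ} (ρ : Ren Γ Δ) (t : Tm Γ τ) →
              rename (liftR {σ = σ} ρ) (wk t) ≡ wk (rename ρ t)
  rename-wk ρ t = trans (rename-∘ (liftR ρ) there t) (sym (rename-∘ there ρ t))

  subst-sub₀ : ∀ {Γ Δ σ τ} (θ : Sub Γ Δ) (t : Tm (σ ∷ Γ) τ) (u : Tm Γ σ) →
               subst θ (t [ u ]₀) ≡ subst (liftS θ) t [ subst θ u ]₀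
  subst-sub₀ θ t u =
    trans (subst-subst θ (sub₀ u) t)
          (trans (subst-cong (λ { here → refl
                                ; (there x) → sym (trans (subst-rename (sub₀ (subst θ u)) there (θ x))
                                                         (subst-var (θ x))) }) t)
                 (sym (subst-subst (sub₀ (subst θ u)) (liftS θ) t)))

  rename-sub₀ : ∀ {Γ Δ σ τ} (ρ : Ren Γ Δ) (t : Tm (σ ∷ Γ) τ) (u : Tm Γ σ) →
                rename ρ (t [ u ]₀) ≡ rename (liftR ρ) t [ rename ρ u ]₀
  rename-sub₀ ρ t u =
    trans (rename-subst ρ (sub₀ u) t)
          (trans (subst-cong (λ { here → refl ; (there x) → refl }) t)
                 (sym (subst-rename (sub₀ (rename ρ u)) (liftR ρ) t)))

  sub₀-var-here : ∀ {Γ σ τ} (t : Tm (σ ∷ Γ) τ) → rename (liftR there) t [ var here ]₀ ≡ t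
  sub₀-var-here t =
    trans (subst-rename (sub₀ (var here)) (liftR there) t)
          (trans (subst-cong (λ { here → refl ; (there x) → refl }) t) (subst-var t))

  rename-wk₀ : ∀ {Γ Δ τ} (ρ : Ren Γ Δ) (t : Tm [] τ) → rename ρ (wk₀ t) ≡ wk₀ t
  rename-wk₀ ρ t = trans (rename-∘ ρ (λ ()) t) (rename-cong (λ ()) t)

  subst-wk₀ : ∀ {Γ Δ τ} (θ : Sub Γ Δ) (t : Tm [] τ) → subst θ (wk₀ t) ≡ wk₀ t
  subst-wk₀ θ t =
    trans (subst-rename θ (λ ()) t)
          (trans (subst-cong (λ ()) t) (sym (rename-as-subst (λ ()) t)))

  ∀* : ∀ as {Γ} → Tm (ext as Γ) o → Tm Γ o
  ∀* []       F = F
  ∀* (a ∷ as) F = ∀̇ a (lam (∀* as F))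

  ∅ˢ : ∀ {Δ} → Sub [] Δ
  ∅ˢ ()

  _,,_ : ∀ {Γ Δ σ} → Sub Γ Δ → Tm Δ σ → Sub (σ ∷ Γ) Δ
  (θ ,, u) here      = u
  (θ ,, u) (there x) = θ x

  extS : ∀ as {Γ Δ} → Sub Γ Δ → TmArgs Δ as → Sub (ext as Γ) Δ
  extS []       θ []       = θ
  extS (a ∷ as) θ (u ∷ us) = extS as (θ ,, u) us

  liftExtS : ∀ as {Γ Δ} → Sub Γ Δ → Sub (ext as Γ) (ext as Δ)
  liftExtS []       θ = θ
  liftExtS (a ∷ as) θ = liftExtS as (liftS θ)

  substArgs : ∀ {Γ Δ as} → Sub Γ Δ → TmArgs Γ as → TmArgs Δ as
  substArgs θ []       = []
  substArgs θ (t ∷ ts) = subst θ t ∷ substArgs θ ts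

  instArgs : ∀ as {Γ bs} → All (λ _ → ℕ) as → TmArgs (ext as Γ) bs → TmArgs Γ bs
  instArgs as ns []       = []
  instArgs as ns (t ∷ ts) = inst as ns t ∷ instArgs as ns ts

  extS-cong : ∀ as {Γ Δ} {θ θ' : Sub Γ Δ} (us : TmArgs Δ as) → θ ≗ˢ θ' →
              extS as θ us ≗ˢ extS as θ' us
  extS-cong []       []       e = e
  extS-cong (a ∷ as) (u ∷ us) e =
    extS-cong as us (λ { here → refl ; (there x) → e x })

  extS-extWk : ∀ as {Γ Δ} (θ : Sub Γ Δ) (us : TmArgs Δ as) {τ} (v : Γ ∋ τ) →
               extS as θ us (extWk as v) ≡ θ v
  extS-extWk []       θ []       v = refl
  extS-extWk (a ∷ as) θ (u ∷ us) v = extS-extWk as (θ ,, u) us (there v)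

  extS-extVars : ∀ as {Γ Δ} (θ : Sub Γ Δ) (us : TmArgs Δ as) →
                 substArgs (extS as θ us) (extVars as Γ) ≡ us
  extS-extVars []       θ []       = refl
  extS-extVars (a ∷ as) θ (u ∷ us) =
    cong₂ _∷_ (extS-extWk as (θ ,, u) us here) (extS-extVars as (θ ,, u) us)

  extS-η : ∀ as {Γ Δ} (θ : Sub (ext as Γ) Δ) →
           θ ≗ˢ extS as (θ ∘ extWk as) (substArgs θ (extVars as Γ))
  extS-η []       θ x = refl
  extS-η (a ∷ as) θ x =
    trans (extS-η as θ x)
          (extS-cong as (substArgs θ (extVars as _)) (λ { here → refl ; (there y) → refl }) x)

  extS-liftExt : ∀ as {Γ Δ Ε} (θ : Sub Δ Ε) (ρ : Ren Γ Δ) (us : TmArgs Ε as) {τ}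
                 (v : ext as Γ ∋ τ) → extS as θ us (liftExt as ρ v) ≡ extS as (θ ∘ ρ) us v
  extS-liftExt []       θ ρ []       v = refl
  extS-liftExt (a ∷ as) θ ρ (u ∷ us) v =
    trans (extS-liftExt as (θ ,, u) (liftR ρ) us v)
          (extS-cong as us (λ { here → refl ; (there y) → refl }) v)

  extS-liftExtS : ∀ as {Γ Δ Ε} (θ : Sub Δ Ε) (θ' : Sub Γ Δ) (us : TmArgs Ε as) {τ}
                  (v : ext as Γ ∋ τ) →
                  subst (extS as θ us) (liftExtS as θ' v) ≡ extS as (subst θ ∘ θ') us v
  extS-liftExtS []       θ θ' []       v = refl
  extS-liftExtS (a ∷ as) θ θ' (u ∷ us) v =
    trans (extS-liftExtS as (θ ,, u) (liftS θ') us v)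
          (extS-cong as us (λ { here → refl ; (there y) → subst-rename (θ ,, u) there (θ' y) }) v)

  liftExtS-cong : ∀ as {Γ Δ} {θ θ' : Sub Γ Δ} → θ ≗ˢ θ' → liftExtS as θ ≗ˢ liftExtS as θ'
  liftExtS-cong []       e = e
  liftExtS-cong (a ∷ as) e = liftExtS-cong as (liftS-cong e)

  liftExtS-extWk : ∀ as {Γ Δ} (θ : Sub Γ Δ) {τ} (v : Γ ∋ τ) →
                   liftExtS as θ (extWk as v) ≡ rename (extWk as) (θ v)
  liftExtS-extWk []       θ v = sym (rename-id (θ v))
  liftExtS-extWk (a ∷ as) θ v =
    trans (liftExtS-extWk as (liftS θ) (there v)) (rename-∘ (extWk as) there (θ v))

  liftExtS-liftExt : ∀ as {Γ Δ Ε} (θ : Sub Δ Ε) (ρ : Ren Γ Δ) {τ} (v : ext as Γ ∋ τ) →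
                     liftExtS as θ (liftExt as ρ v) ≡ liftExtS as (θ ∘ ρ) v
  liftExtS-liftExt []       θ ρ v = refl
  liftExtS-liftExt (a ∷ as) θ ρ v =
    trans (liftExtS-liftExt as (liftS θ) (liftR ρ) v)
          (liftExtS-cong as (λ { here → refl ; (there y) → refl }) v)

  liftExt-extWk : ∀ as {Γ Δ} (ρ : Ren Γ Δ) {τ} (v : Γ ∋ τ) →
                  liftExt as ρ (extWk as v) ≡ extWk as (ρ v)
  liftExt-extWk []       ρ v = refl
  liftExt-extWk (a ∷ as) ρ v = liftExt-extWk as (liftR ρ) (there v)

  renameArgs-extVars : ∀ as {Γ Δ} (ρ : Ren Γ Δ) →
                       renameArgs (liftExt as ρ) (extVars as Γ) ≡ extVars as Δ
  renameArgs-extVars []       ρ = refl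
  renameArgs-extVars (a ∷ as) ρ =
    cong₂ _∷_ (cong var (liftExt-extWk as (liftR ρ) here)) (renameArgs-extVars as (liftR ρ))

  substArgs-cong : ∀ {Γ Δ as} {θ θ' : Sub Γ Δ} → θ ≗ˢ θ' → (ts : TmArgs Γ as) →
                   substArgs θ ts ≡ substArgs θ' ts
  substArgs-cong e []       = refl
  substArgs-cong e (t ∷ ts) = cong₂ _∷_ (subst-cong e t) (substArgs-cong e ts)

  substArgs-renameArgs : ∀ {Γ Δ Ε as} (θ : Sub Δ Ε) (ρ : Ren Γ Δ) (ts : TmArgs Γ as) →
                         substArgs θ (renameArgs ρ ts) ≡ substArgs (θ ∘ ρ) ts
  substArgs-renameArgs θ ρ []       = refl
  substArgs-renameArgs θ ρ (t ∷ ts) =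
    cong₂ _∷_ (subst-rename θ ρ t) (substArgs-renameArgs θ ρ ts)

  substArgs-substArgs : ∀ {Γ Δ Ε as} (θ : Sub Δ Ε) (θ' : Sub Γ Δ) (ts : TmArgs Γ as) →
                        substArgs θ (substArgs θ' ts) ≡ substArgs (subst θ ∘ θ') ts
  substArgs-substArgs θ θ' []       = refl
  substArgs-substArgs θ θ' (t ∷ ts) =
    cong₂ _∷_ (subst-subst θ θ' t) (substArgs-substArgs θ θ' ts)

  rename-apps : ∀ {Γ Δ as τ} (ρ : Ren Γ Δ) (f : Tm Γ (as ⇛ τ)) (ts : TmArgs Γ as) →
                rename ρ (apps f ts) ≡ apps (rename ρ f) (renameArgs ρ ts)
  rename-apps ρ f []       = refl
  rename-apps ρ f (t ∷ ts) = rename-apps ρ (app f t) ts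

  subst-apps : ∀ {Γ Δ as τ} (θ : Sub Γ Δ) (f : Tm Γ (as ⇛ τ)) (ts : TmArgs Γ as) →
               subst θ (apps f ts) ≡ apps (subst θ f) (substArgs θ ts)
  subst-apps θ f []       = refl
  subst-apps θ f (t ∷ ts) = subst-apps θ (app f t) ts

  rename-lams : ∀ as {Γ Δ τ} (ρ : Ren Γ Δ) (t : Tm (ext as Γ) τ) →
                rename ρ (lams as t) ≡ lams as (rename (liftExt as ρ) t)
  rename-lams []       ρ t = refl
  rename-lams (a ∷ as) ρ t = cong lam (rename-lams as (liftR ρ) t)

  subst-lams : ∀ as {Γ Δ τ} (θ : Sub Γ Δ) (t : Tm (ext as Γ) τ) →
               subst θ (lams as t) ≡ lams as (subst (liftExtS as θ) t)
  subst-lams []       θ t = refl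
  subst-lams (a ∷ as) θ t = cong lam (subst-lams as (liftS θ) t)

  rename-hApp : ∀ {Γ Δ} cs {a} (ρ : Ren Γ Δ) (f : Tm Γ ⌜ hTy cs a ⌝) →
                rename ρ (hApp cs f) ≡ hApp cs (rename ρ f)
  rename-hApp []             ρ f = refl
  rename-hApp ((b , n) ∷ cs) ρ f = rename-hApp cs ρ (app f (nom b n))

  subst-∃* : ∀ as {Γ Δ} (θ : Sub Γ Δ) (F : Tm (ext as Γ) o) →
             subst θ (∃* as F) ≡ ∃* as (subst (liftExtS as θ) F)
  subst-∃* []       θ F = refl
  subst-∃* (a ∷ as) θ F = cong (λ G → ∃̇ a (lam G)) (subst-∃* as (liftS θ) F)

  subst-∀* : ∀ as {Γ Δ} (θ : Sub Γ Δ) (F : Tm (ext as Γ) o) →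
             subst θ (∀* as F) ≡ ∀* as (subst (liftExtS as θ) F)
  subst-∀* []       θ F = refl
  subst-∀* (a ∷ as) θ F = cong (λ G → ∀̇ a (lam G)) (subst-∀* as (liftS θ) F)

  subst-∇* : ∀ as {Γ Δ} (θ : Sub Γ Δ) (F : Tm (ext as Γ) o) →
             subst θ (∇* as F) ≡ ∇* as (subst (liftExtS as θ) F)
  subst-∇* []       θ F = refl
  subst-∇* (a ∷ as) θ F = cong (λ G → ∇̇ a (lam G)) (subst-∇* as (liftS θ) F)

  rename-∀* : ∀ as {Γ Δ} (ρ : Ren Γ Δ) (F : Tm (ext as Γ) o) →
              rename ρ (∀* as F) ≡ ∀* as (rename (liftExt as ρ) F)
  rename-∀* []       ρ F = refl
  rename-∀* (a ∷ as) ρ F = cong (λ G → ∀̇ a (lam G)) (rename-∀* as (liftR ρ) F)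

  rename-∇* : ∀ as {Γ Δ} (ρ : Ren Γ Δ) (F : Tm (ext as Γ) o) →
              rename ρ (∇* as F) ≡ ∇* as (rename (liftExt as ρ) F)
  rename-∇* []       ρ F = refl
  rename-∇* (a ∷ as) ρ F = cong (λ G → ∇̇ a (lam G)) (rename-∇* as (liftR ρ) F)

  subst-⋁ : ∀ {Γ Δ} (θ : Sub Γ Δ) (Fs : List (Tm Γ o)) → subst θ (⋁ Fs) ≡ ⋁ (map (subst θ) Fs)
  subst-⋁ θ []           = refl
  subst-⋁ θ (F ∷ [])     = refl
  subst-⋁ θ (F ∷ G ∷ Fs) = cong (subst θ F ∨̇_) (subst-⋁ θ (G ∷ Fs))

  rename-inst : ∀ as {Γ Δ τ} (ρ : Ren Γ Δ) ns (t : Tm (ext as Γ) τ) →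
                rename ρ (inst as ns t) ≡ inst as ns (rename (liftExt as ρ) t)
  rename-inst []       ρ []       t = refl
  rename-inst (a ∷ as) ρ (n ∷ ns) t =
    trans (rename-sub₀ ρ (inst as ns t) (nom a n))
          (cong (_[ nom a n ]₀) (rename-inst as (liftR ρ) ns t))

  inst-liftExtS : ∀ as {Γ Δ τ} (θ : Sub Γ Δ) ns (F : Tm (ext as Γ) τ) →
                  inst as ns (subst (liftExtS as θ) F) ≡ subst θ (inst as ns F)
  inst-liftExtS []       θ []       F = refl
  inst-liftExtS (a ∷ as) θ (n ∷ ns) F =
    trans (cong (_[ nom a n ]₀) (inst-liftExtS as (liftS θ) ns F))
          (sym (subst-sub₀ θ (inst as ns F) (nom a n)))

  inst-apps : ∀ as {Γ bs τ} ns (f : Tm (ext as Γ) (bs ⇛ τ)) (ts : TmArgs (ext as Γ) bs) →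
              inst as ns (apps f ts) ≡ apps (inst as ns f) (instArgs as ns ts)
  inst-apps []       []       f ts = cong (apps f) (instArgs-[] ts)
    where
      instArgs-[] : ∀ {Γ bs} (ts : TmArgs Γ bs) → ts ≡ instArgs [] [] ts
      instArgs-[] []       = refl
      instArgs-[] (t ∷ ts) = cong (t ∷_) (instArgs-[] ts)
  inst-apps (a ∷ as) (n ∷ ns) f ts =
    trans (cong (_[ nom a n ]₀) (inst-apps as ns f ts))
          (trans (subst-apps (sub₀ (nom a n)) (inst as ns f) (instArgs as ns ts))
                 (cong (apps _) (sub₀-instArgs ts)))
    where
      sub₀-instArgs : ∀ {bs} (ts : TmArgs _ bs) →
                      substArgs (sub₀ (nom a n)) (instArgs as ns ts) ≡ instArgs (a ∷ as) (n ∷ ns) ts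
      sub₀-instArgs []       = refl
      sub₀-instArgs (t ∷ ts) = cong (_ ∷_) (sub₀-instArgs ts)

  inst-wk₀ : ∀ as {Γ τ} ns (S : Tm [] τ) → inst as {Γ} ns (wk₀ S) ≡ wk₀ S
  inst-wk₀ []       []       S = refl
  inst-wk₀ (a ∷ as) (n ∷ ns) S = trans (cong (_[ nom a n ]₀) (inst-wk₀ as ns S)) (subst-wk₀ _ S)

  inst-con : ∀ as {Γ τ} ns (k : K τ) → inst as {Γ} ns (con k) ≡ con k
  inst-con []       []       k = refl
  inst-con (a ∷ as) (n ∷ ns) k = cong (_[ nom a n ]₀) (inst-con as ns k)

  ≡⇒≐ : ∀ {Γ τ} {t u : Tm Γ τ} → t ≡ u → t ≐ u
  ≡⇒≐ refl = ≐refl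

  ≐-rename : ∀ {Γ Δ τ} (ρ : Ren Γ Δ) {t u : Tm Γ τ} → t ≐ u → rename ρ t ≐ rename ρ u
  ≐-rename ρ ≐refl        = ≐refl
  ≐-rename ρ (≐sym p)     = ≐sym (≐-rename ρ p)
  ≐-rename ρ (≐trans p q) = ≐trans (≐-rename ρ p) (≐-rename ρ q)
  ≐-rename ρ (≐lam p)     = ≐lam (≐-rename (liftR ρ) p)
  ≐-rename ρ (≐app p q)   = ≐app (≐-rename ρ p) (≐-rename ρ q)
  ≐-rename ρ (≐β t u)     = ≐trans (≐β _ _) (≡⇒≐ (sym (rename-sub₀ ρ t u)))
  ≐-rename ρ (≐η t)       = ≐trans (≐η _) (≐lam (≐app (≡⇒≐ (sym (rename-wk ρ t))) ≐refl))

  ≐-subst : ∀ {Γ Δ τ} (θ : Sub Γ Δ) {t u : Tm Γ τ} → t ≐ u → subst θ t ≐ subst θ u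
  ≐-subst θ ≐refl        = ≐refl
  ≐-subst θ (≐sym p)     = ≐sym (≐-subst θ p)
  ≐-subst θ (≐trans p q) = ≐trans (≐-subst θ p) (≐-subst θ q)
  ≐-subst θ (≐lam p)     = ≐lam (≐-subst (liftS θ) p)
  ≐-subst θ (≐app p q)   = ≐app (≐-subst θ p) (≐-subst θ q)
  ≐-subst θ (≐β t u)     = ≐trans (≐β _ _) (≡⇒≐ (sym (subst-sub₀ θ t u)))
  ≐-subst θ (≐η t)       = ≐trans (≐η _) (≐lam (≐app (≡⇒≐ (sym (subst-wk θ t))) ≐refl))

  subst-≐ : ∀ {Γ Δ τ} {θ θ' : Sub Γ Δ} → (∀ {σ} (x : Γ ∋ σ) → θ x ≐ θ' x) →
            (t : Tm Γ τ) → subst θ t ≐ subst θ' t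
  subst-≐ e (var x)   = e x
  subst-≐ e (con k)   = ≐refl
  subst-≐ e (nom a n) = ≐refl
  subst-≐ e (lc c)    = ≐refl
  subst-≐ e (lam t)   = ≐lam (subst-≐ (λ { here → ≐refl ; (there x) → ≐-rename there (e x) }) t)
  subst-≐ e (app t u) = ≐app (subst-≐ e t) (subst-≐ e u)

  ≐-inst : ∀ as {Γ τ} ns {F G : Tm (ext as Γ) τ} → F ≐ G → inst as ns F ≐ inst as ns G
  ≐-inst []       []       p = p
  ≐-inst (a ∷ as) (n ∷ ns) p = ≐-subst (sub₀ (nom a n)) (≐-inst as ns p)

  lam-injective : ∀ {Γ σ τ} {t u : Tm (σ ∷ Γ) τ} → lam t ≐ lam u → t ≐ u
  lam-injective {t = t} {u} p =
    ≐trans (≡⇒≐ (sym (sub₀-var-here t)))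
      (≐trans (≐sym (≐β _ _))
        (≐trans (≐app (≐-rename there p) ≐refl)
          (≐trans (≐β _ _) (≡⇒≐ (sub₀-var-here u)))))

  lams-injective : ∀ as {Γ τ} {t u : Tm (ext as Γ) τ} → lams as t ≐ lams as u → t ≐ u
  lams-injective []       p = p
  lams-injective (a ∷ as) p = lams-injective as (lam-injective p)

  _≐ᴬ_ : ∀ {Γ as} → TmArgs Γ as → TmArgs Γ as → Set
  []       ≐ᴬ []       = ⊤
  (t ∷ ts) ≐ᴬ (u ∷ us) = (t ≐ u) × (ts ≐ᴬ us)

  ≐ᴬ-sym : ∀ {Γ as} {us vs : TmArgs Γ as} → us ≐ᴬ vs → vs ≐ᴬ us
  ≐ᴬ-sym {us = []}    {[]}    _        = tt
  ≐ᴬ-sym {us = _ ∷ _} {_ ∷ _} (p , ps) = ≐sym p , ≐ᴬ-sym ps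

  apps-≐ˡ : ∀ {Γ as τ} {f g : Tm Γ (as ⇛ τ)} (ts : TmArgs Γ as) → f ≐ g → apps f ts ≐ apps g ts
  apps-≐ˡ []       p = p
  apps-≐ˡ (t ∷ ts) p = apps-≐ˡ ts (≐app p ≐refl)

  apps-≐ʳ : ∀ {Γ as τ} (f : Tm Γ (as ⇛ τ)) {ts us : TmArgs Γ as} → ts ≐ᴬ us → apps f ts ≐ apps f us
  apps-≐ʳ f {[]}     {[]}     _        = ≐refl
  apps-≐ʳ f {t ∷ ts} {u ∷ us} (p , ps) =
    ≐trans (apps-≐ˡ ts (≐app ≐refl p)) (apps-≐ʳ (app f u) ps)

  apps-lams-β : ∀ as {Γ Δ τ} (θ : Sub Γ Δ) (b : Tm (ext as Γ) τ) (us : TmArgs Δ as) →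
                apps (subst θ (lams as b)) us ≐ subst (extS as θ us) b
  apps-lams-β []       θ b []       = ≐refl
  apps-lams-β (a ∷ as) θ b (u ∷ us) =
    ≐trans (apps-≐ˡ us (≐β _ _))
      (≐trans (≡⇒≐ (cong (λ f → apps f us)
                (trans (subst-subst (sub₀ u) (liftS θ) (lams as b))
                       (subst-cong (λ { here → refl
                                      ; (there y) → trans (subst-rename (sub₀ u) there (θ y))
                                                          (subst-var (θ y)) }) (lams as b)))))
              (apps-lams-β as (θ ,, u) b us))

  β-wk-here : ∀ {Γ σ} (E : Tm (σ ∷ Γ) o) → app (wk (lam E)) (var here) ≐ E
  β-wk-here E = ≐trans (≐β _ _) (≡⇒≐ (sub₀-var-here E))

  perm-rename : ∀ {Γ Δ τ} (π : Perm) (ρ : Ren Γ Δ) (t : Tm Γ τ) →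
                π · rename ρ t ≡ rename ρ (π · t)
  perm-rename π ρ (var x)   = refl
  perm-rename π ρ (con k)   = refl
  perm-rename π ρ (nom a n) = refl
  perm-rename π ρ (lc c)    = refl
  perm-rename π ρ (lam t)   = cong lam (perm-rename π (liftR ρ) t)
  perm-rename π ρ (app t u) = cong₂ app (perm-rename π ρ t) (perm-rename π ρ u)

  perm-subst : ∀ {Γ Δ τ} (π : Perm) (θ : Sub Γ Δ) (t : Tm Γ τ) →
               π · subst θ t ≡ subst (λ x → π · θ x) (π · t)
  perm-subst π θ (var x)   = refl
  perm-subst π θ (con k)   = refl
  perm-subst π θ (nom a n) = refl
  perm-subst π θ (lc c)    = refl
  perm-subst π θ (lam t)   =
    cong lam (trans (perm-subst π (liftS θ) t)
                    (subst-cong (λ { here → refl ; (there x) → perm-rename π there (θ x) }) (π · t)))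
  perm-subst π θ (app t u) = cong₂ app (perm-subst π θ t) (perm-subst π θ u)

  perm-sub₀ : ∀ {Γ σ τ} (π : Perm) (t : Tm (σ ∷ Γ) τ) (u : Tm Γ σ) →
              π · (t [ u ]₀) ≡ (π · t) [ π · u ]₀
  perm-sub₀ π t u =
    trans (perm-subst π (sub₀ u) t) (subst-cong (λ { here → refl ; (there x) → refl }) (π · t))

  ≐-perm : ∀ {Γ τ} (π : Perm) {t u : Tm Γ τ} → t ≐ u → π · t ≐ π · u
  ≐-perm π ≐refl        = ≐refl
  ≐-perm π (≐sym p)     = ≐sym (≐-perm π p)
  ≐-perm π (≐trans p q) = ≐trans (≐-perm π p) (≐-perm π q)
  ≐-perm π (≐lam p)     = ≐lam (≐-perm π p)
  ≐-perm π (≐app p q)   = ≐app (≐-perm π p) (≐-perm π q)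
  ≐-perm π (≐β t u)     = ≐trans (≐β _ _) (≡⇒≐ (sym (perm-sub₀ π t u)))
  ≐-perm π (≐η t)       = ≐trans (≐η _) (≐lam (≐app (≡⇒≐ (sym (perm-rename π there t))) ≐refl))

  idPerm : Perm
  idPerm = record
    { fwd = λ _ n → n ; bwd = λ _ n → n ; left = λ _ _ → refl ; right = λ _ _ → refl
    ; finite = [] , λ _ _ n≢n → ⊥-elim (n≢n refl) }

  idPerm-· : ∀ {Γ τ} (t : Tm Γ τ) → idPerm · t ≡ t
  idPerm-· (var x)   = refl
  idPerm-· (con k)   = refl
  idPerm-· (nom a n) = refl
  idPerm-· (lc c)    = refl
  idPerm-· (lam t)   = cong lam (idPerm-· t)
  idPerm-· (app t u) = cong₂ app (idPerm-· t) (idPerm-· u)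

  ≐⇒≈ : ∀ {Γ τ} {t u : Tm Γ τ} → t ≐ u → t ≈ u
  ≐⇒≈ {u = u} p = idPerm , ≐trans p (≡⇒≐ (sym (idPerm-· u)))

  perm-¬OccN : ∀ {Γ τ} (π : Perm) (t : Tm Γ τ) → (∀ c → ¬ OccN c t) → π · t ≡ t
  perm-¬OccN π (var x)   h = refl
  perm-¬OccN π (con k)   h = refl
  perm-¬OccN π (nom a n) h = ⊥-elim (h (a , n) refl)
  perm-¬OccN π (lc c)    h = refl
  perm-¬OccN π (lam t)   h = cong lam (perm-¬OccN π t h)
  perm-¬OccN π (app t u) h = cong₂ app (perm-¬OccN π t (λ c → h c ∘ inj₁))
                                      (perm-¬OccN π u (λ c → h c ∘ inj₂))

  perm-NomFree : ∀ {Γ τ} (π : Perm) {t : Tm Γ τ} → NomFree t → π · t ≐ t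
  perm-NomFree π (t' , t≐t' , h) =
    ≐trans (≐-perm π t≐t') (≐trans (≡⇒≐ (perm-¬OccN π t' h)) (≐sym t≐t'))

  OccN-rename : ∀ {Γ Δ τ} (ρ : Ren Γ Δ) c (t : Tm Γ τ) → OccN c (rename ρ t) → OccN c t
  OccN-rename ρ c (nom a n) oc        = oc
  OccN-rename ρ c (lam t)   oc        = OccN-rename (liftR ρ) c t oc
  OccN-rename ρ c (app t u) (inj₁ oc) = inj₁ (OccN-rename ρ c t oc)
  OccN-rename ρ c (app t u) (inj₂ oc) = inj₂ (OccN-rename ρ c u oc)

  OccNˢ : ∀ {Γ Δ} → Nom → Sub Γ Δ → Set
  OccNˢ {Γ} c θ = ∃[ τ ] Σ (Γ ∋ τ) λ x → OccN c (θ x)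

  OccN-subst : ∀ {Γ Δ τ} (θ : Sub Γ Δ) c (t : Tm Γ τ) →
               OccN c (subst θ t) → OccN c t ⊎ OccNˢ c θ
  OccN-subst θ c (var x)   oc = inj₂ (_ , x , oc)
  OccN-subst θ c (nom a n) oc = inj₁ oc
  OccN-subst θ c (lam t)   oc with OccN-subst (liftS θ) c t oc
  ... | inj₁ oc'                = inj₁ oc'
  ... | inj₂ (_ , there x , oc') = inj₂ (_ , x , OccN-rename there c (θ x) oc')
  OccN-subst θ c (app t u) (inj₁ oc) = map₁ inj₁ (OccN-subst θ c t oc)
  OccN-subst θ c (app t u) (inj₂ oc) = map₁ inj₂ (OccN-subst θ c u oc)

  OccN-∇* : ∀ as {Γ} c (F : Tm (ext as Γ) o) → OccN c (∇* as F) → OccN c F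
  OccN-∇* []       c F oc        = oc
  OccN-∇* (a ∷ as) c F (inj₂ oc) = OccN-∇* as c F oc

  OccN-liftExtS-sub₀ : ∀ as {Γ} a n c {τ} (x : ext as (⌜ a ⌝ ∷ Γ) ∋ τ) →
                       OccN c (liftExtS as (sub₀ (nom a n)) x) → (a , n) ≡ c
  OccN-liftExtS-sub₀ as a n c =
    go as (sub₀ (nom a n)) (λ { here e → e ; (there y) () })
    where
      go : ∀ bs {Γ Δ} (θ : Sub Γ Δ) → (∀ {τ} (y : Γ ∋ τ) → OccN c (θ y) → (a , n) ≡ c) →
           ∀ {τ} (y : ext bs Γ ∋ τ) → OccN c (liftExtS bs θ y) → (a , n) ≡ c
      go []       θ h = h
      go (b ∷ bs) θ h =
        go bs (liftS θ) (λ { here () ; (there z) oc → h z (OccN-rename there c (θ z) oc) })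

  NomFreeˢ : ∀ {Γ Δ} → Sub Γ Δ → Set
  NomFreeˢ {Γ} θ = ∀ {τ} (x : Γ ∋ τ) → NomFree (θ x)

  NomFree-var : ∀ {Γ τ} (x : Γ ∋ τ) → NomFree (var x)
  NomFree-var x = var x , ≐refl , λ _ ()

  NomFree-con : ∀ {Γ τ} (k : K τ) → NomFree {Γ} (con k)
  NomFree-con k = con k , ≐refl , λ _ ()

  NomFree-lc : ∀ {Γ τ} (c : LogC τ) → NomFree {Γ} (lc c)
  NomFree-lc c = lc c , ≐refl , λ _ ()

  NomFree-lam : ∀ {Γ σ τ} {t : Tm (σ ∷ Γ) τ} → NomFree t → NomFree (lam t)
  NomFree-lam (t' , t≐t' , h) = lam t' , ≐lam t≐t' , h

  NomFree-app : ∀ {Γ σ τ} {t : Tm Γ (σ ⇒ τ)} {u : Tm Γ σ} →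
                NomFree t → NomFree u → NomFree (app t u)
  NomFree-app (t' , t≐t' , h) (u' , u≐u' , g) =
    app t' u' , ≐app t≐t' u≐u' , λ c → [ h c , g c ]

  NomFree-rename : ∀ {Γ Δ τ} (ρ : Ren Γ Δ) {t : Tm Γ τ} → NomFree t → NomFree (rename ρ t)
  NomFree-rename ρ (t' , t≐t' , h) =
    rename ρ t' , ≐-rename ρ t≐t' , λ c oc → h c (OccN-rename ρ c t' oc)

  NomFree-subst : ∀ {Γ Δ τ} {θ : Sub Γ Δ} {t : Tm Γ τ} → NomFree t → NomFreeˢ θ →
                  NomFree (subst θ t)
  NomFree-subst {θ = θ} (t' , t≐t' , h) hθ =
    subst θ' t' ,
    ≐trans (≐-subst θ t≐t') (subst-≐ (λ x → proj₁ (proj₂ (hθ x))) t') ,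
    λ c oc → [ h c , (λ { (_ , x , oc') → proj₂ (proj₂ (hθ x)) c oc' }) ] (OccN-subst θ' c t' oc)
    where
      θ' : Sub _ _
      θ' x = proj₁ (hθ x)

  NomFree-wk₀ : ∀ {Γ τ} {t : Tm [] τ} → NomFree t → NomFree {Γ} (wk₀ t)
  NomFree-wk₀ = NomFree-rename (λ ())

  NomFree-apps : ∀ {Γ as τ} {f : Tm Γ (as ⇛ τ)} (ts : TmArgs Γ as) →
                 NomFree f → ArgsNomFree ts → NomFree (apps f ts)
  NomFree-apps []       h _        = h
  NomFree-apps (t ∷ ts) h (g , gs) = NomFree-apps ts (NomFree-app h g) gs

  NomFree-lams : ∀ as {Γ τ} {t : Tm (ext as Γ) τ} → NomFree t → NomFree (lams as t)
  NomFree-lams []       h = h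
  NomFree-lams (a ∷ as) h = NomFree-lam (NomFree-lams as h)

  NomFree-∃* : ∀ as {Γ} {F : Tm (ext as Γ) o} → NomFree F → NomFree (∃* as F)
  NomFree-∃* []       h = h
  NomFree-∃* (a ∷ as) h = NomFree-app (NomFree-lc _) (NomFree-lam (NomFree-∃* as h))

  NomFree-∀* : ∀ as {Γ} {F : Tm (ext as Γ) o} → NomFree F → NomFree (∀* as F)
  NomFree-∀* []       h = h
  NomFree-∀* (a ∷ as) h = NomFree-app (NomFree-lc _) (NomFree-lam (NomFree-∀* as h))

  NomFree-∇* : ∀ as {Γ} {F : Tm (ext as Γ) o} → NomFree F → NomFree (∇* as F)
  NomFree-∇* []       h = h
  NomFree-∇* (a ∷ as) h = NomFree-app (NomFree-lc _) (NomFree-lam (NomFree-∇* as h))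

  ArgsNomFree-renameArgs : ∀ {Γ Δ as} (ρ : Ren Γ Δ) (ts : TmArgs Γ as) → ArgsNomFree ts →
                           ArgsNomFree (renameArgs ρ ts)
  ArgsNomFree-renameArgs ρ []       _        = tt
  ArgsNomFree-renameArgs ρ (t ∷ ts) (g , gs) = NomFree-rename ρ g , ArgsNomFree-renameArgs ρ ts gs

  ArgsNomFree-extVars : ∀ as Γ → ArgsNomFree (extVars as Γ)
  ArgsNomFree-extVars []       Γ = tt
  ArgsNomFree-extVars (a ∷ as) Γ = NomFree-var _ , ArgsNomFree-extVars as _

  NomFreeˢ-liftS : ∀ {Γ Δ σ} {θ : Sub Γ Δ} → NomFreeˢ θ → NomFreeˢ (liftS {σ = σ} θ)
  NomFreeˢ-liftS h here      = NomFree-var here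
  NomFreeˢ-liftS h (there x) = NomFree-rename there (h x)

  NomFreeˢ-liftExtS : ∀ as {Γ Δ} {θ : Sub Γ Δ} → NomFreeˢ θ → NomFreeˢ (liftExtS as θ)
  NomFreeˢ-liftExtS []       h = h
  NomFreeˢ-liftExtS (a ∷ as) h = NomFreeˢ-liftExtS as (NomFreeˢ-liftS h)

  NomFreeˢ-extS : ∀ as {Γ Δ} {θ : Sub Γ Δ} (us : TmArgs Δ as) → NomFreeˢ θ → ArgsNomFree us →
                  NomFreeˢ (extS as θ us)
  NomFreeˢ-extS []       []       h _        = h
  NomFreeˢ-extS (a ∷ as) (u ∷ us) h (g , gs) =
    NomFreeˢ-extS as us (λ { here → g ; (there x) → h x }) gs

  NomFree⇒ListsSupp[] : ∀ {Γ τ} {t : Tm Γ τ} → NomFree t → ListsSupp [] t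
  NomFree⇒ListsSupp[] (t' , t≐t' , h) = [] , (λ _ ()) , t' , t≐t' , λ c oc → ⊥-elim (h c oc)

  -- Weak normalisation

  Neutral : ∀ {Γ τ} → Tm Γ τ → Set
  Neutral t = Normal t × NotLam t

  Normalisable : ∀ {Γ τ} → Tm Γ τ → Set
  Normalisable {Γ} {τ} t = ∃[ n ] (Normal n × t ≐ n)

  NotLam-rename : ∀ {Γ Δ τ} (ρ : Ren Γ Δ) (t : Tm Γ τ) → NotLam t → NotLam (rename ρ t)
  NotLam-rename ρ (var x)   _ = tt
  NotLam-rename ρ (con k)   _ = tt
  NotLam-rename ρ (nom a n) _ = tt
  NotLam-rename ρ (lc c)    _ = tt
  NotLam-rename ρ (app t u) _ = tt

  Normal-rename : ∀ {Γ Δ τ} (ρ : Ren Γ Δ) (t : Tm Γ τ) → Normal t → Normal (rename ρ t)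
  Normal-rename ρ (var x)   _ = tt
  Normal-rename ρ (con k)   _ = tt
  Normal-rename ρ (nom a n) _ = tt
  Normal-rename ρ (lc c)    _ = tt
  Normal-rename ρ (lam t)   h = Normal-rename (liftR ρ) t h
  Normal-rename ρ (app t u) (nl , nt , nu) =
    NotLam-rename ρ t nl , Normal-rename ρ t nt , Normal-rename ρ u nu

  Reducible : ∀ {Γ} τ → Tm Γ τ → Set
  Reducible {Γ} (σ ⇒ τ) t =
    ∀ {Δ} (ρ : Ren Γ Δ) (u : Tm Δ σ) → Reducible σ u → Reducible τ (app (rename ρ t) u)
  Reducible (ι n) t = Normalisable t
  Reducible o     t = Normalisable t

  Reducible-≐ : ∀ {Γ} τ {t u : Tm Γ τ} → t ≐ u → Reducible τ t → Reducible τ u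
  Reducible-≐ (σ ⇒ τ) p r ρ v rv = Reducible-≐ τ (≐app (≐-rename ρ p) ≐refl) (r ρ v rv)
  Reducible-≐ (ι n)   p (m , nm , q) = m , nm , ≐trans (≐sym p) q
  Reducible-≐ o       p (m , nm , q) = m , nm , ≐trans (≐sym p) q

  Reducible-rename : ∀ {Γ Δ} τ (ρ : Ren Γ Δ) {t : Tm Γ τ} → Reducible τ t → Reducible τ (rename ρ t)
  Reducible-rename (σ ⇒ τ) ρ {t} r ρ' v rv =
    transport (λ f → Reducible τ (app f v)) (sym (rename-∘ ρ' ρ t)) (r (ρ' ∘ ρ) v rv)
  Reducible-rename (ι n) ρ (m , nm , q) = rename ρ m , Normal-rename ρ m nm , ≐-rename ρ q
  Reducible-rename o     ρ (m , nm , q) = rename ρ m , Normal-rename ρ m nm , ≐-rename ρ q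

  reify   : ∀ {Γ} τ {t : Tm Γ τ} → Reducible τ t → Normalisable t
  reflect : ∀ {Γ} τ {t : Tm Γ τ} → Neutral t → Reducible τ t

  reify (σ ⇒ τ) {t} r with reify τ (r there (var here) (reflect σ (tt , tt)))
  ... | m , nm , q = lam m , nm , ≐trans (≐η t) (≐lam q)
  reify (ι n) r = r
  reify o     r = r

  reflect (σ ⇒ τ) {t} (nt , nl) ρ u ru with reify σ ru
  ... | m , nm , q =
    Reducible-≐ τ (≐app ≐refl (≐sym q))
      (reflect τ ((NotLam-rename ρ t nl , Normal-rename ρ t nt , nm) , tt))
  reflect (ι n) {t} (nt , _) = t , nt , ≐refl
  reflect o     {t} (nt , _) = t , nt , ≐refl

  Reducibleˢ : ∀ {Γ Δ} → Sub Γ Δ → Set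
  Reducibleˢ {Γ} θ = ∀ {τ} (x : Γ ∋ τ) → Reducible τ (θ x)

  Reducible-subst : ∀ {Γ Δ τ} (t : Tm Γ τ) (θ : Sub Γ Δ) → Reducibleˢ θ → Reducible τ (subst θ t)
  Reducible-subst (var x)           θ r = r x
  Reducible-subst {τ = τ} (con k)   θ r = reflect τ (tt , tt)
  Reducible-subst (nom a n)         θ r = reflect _ (tt , tt)
  Reducible-subst {τ = τ} (lc c)    θ r = reflect τ (tt , tt)
  Reducible-subst {τ = τ} (app t u) θ r =
    transport (λ f → Reducible τ (app f (subst θ u))) (rename-id (subst θ t))
      (Reducible-subst t θ r (λ x → x) (subst θ u) (Reducible-subst u θ r))
  Reducible-subst {Γ} {Δ} {σ ⇒ τ} (lam t) θ r {Ε} ρ u ru =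
    Reducible-≐ τ (≐sym (≐β _ _))
      (transport (Reducible τ) (sym β-step) (Reducible-subst t ((rename ρ ∘ θ) ,, u) r'))
    where
      r' : Reducibleˢ ((rename ρ ∘ θ) ,, u)
      r' here           = ru
      r' {τ'} (there x) = Reducible-rename τ' ρ (r x)
      β-step : rename (liftR ρ) (subst (liftS θ) t) [ u ]₀ ≡ subst ((rename ρ ∘ θ) ,, u) t
      β-step =
        trans (subst-rename (sub₀ u) (liftR ρ) (subst (liftS θ) t))
          (trans (subst-subst (sub₀ u ∘ liftR ρ) (liftS θ) t)
            (subst-cong (λ { here → refl
                           ; (there x) → trans (subst-rename (sub₀ u ∘ liftR ρ) there (θ x))
                                               (sym (rename-as-subst ρ (θ x))) }) t))

  normalisable : ∀ {Γ τ} (t : Tm Γ τ) → Normalisable t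
  normalisable {τ = τ} t =
    reify τ (transport (Reducible τ) (subst-var t)
                       (Reducible-subst t var (λ {τ'} _ → reflect τ' (tt , tt))))

  -- Replacing the constants of one type by a closed term

  OFreeCtx : List Ty → Set
  OFreeCtx Γ = ∀ {τ} → Γ ∋ τ → OFree τ

  OFreeCtx-⌜⌝ˢ : ∀ Σ' → OFreeCtx ⌜ Σ' ⌝ˢ
  OFreeCtx-⌜⌝ˢ (a ∷ Σ') here      = OFree-⌜⌝ a
  OFreeCtx-⌜⌝ˢ (a ∷ Σ') (there x) = OFreeCtx-⌜⌝ˢ Σ' x

  OFreeCtx-ext : ∀ as {Γ} → OFreeCtx Γ → OFreeCtx (ext as Γ)
  OFreeCtx-ext []       h = h
  OFreeCtx-ext (a ∷ as) h = OFreeCtx-ext as λ { here → OFree-⌜⌝ a ; (there x) → h x }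

  module Replacement (pargs : List ITy) (S : Tm [] (pargs ⇛ o)) (S-nomFree : NomFree S) where

    T : Ty
    T = pargs ⇛ o

    S₀ : Tm [] T
    S₀ = proj₁ S-nomFree

    replaceCon : ∀ {Γ} τ → K τ → Tm Γ τ
    replaceCon {Γ} τ k with τ ≟ᵀ T
    ... | yes τ≡T = transport (Tm Γ) (sym τ≡T) (wk₀ S₀)
    ... | no _    = con k

    replace : ∀ {Γ τ} → Tm Γ τ → Tm Γ τ
    replace (var x)         = var x
    replace {τ = τ} (con k) = replaceCon τ k
    replace (nom a n)       = nom a n
    replace (lc c)          = lc c
    replace (lam t)         = lam (replace t)
    replace (app t u)       = app (replace t) (replace u)

    replaceArgs : ∀ {Γ as} → TmArgs Γ as → TmArgs Γ as
    replaceArgs []       = []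
    replaceArgs (t ∷ ts) = replace t ∷ replaceArgs ts

    replaceCon-T : ∀ {Γ} (k : K T) → replaceCon {Γ} T k ≡ wk₀ S₀
    replaceCon-T {Γ} k with T ≟ᵀ T
    ... | yes T≡T = cong (λ e → transport (Tm Γ) (sym e) (wk₀ S₀))
                         (Decidable⇒UIP.≡-irrelevant _≟ᵀ_ T≡T refl)
    ... | no T≢T  = ⊥-elim (T≢T refl)

    replaceCon-OFree : ∀ {Γ} τ k → OFree τ → replaceCon {Γ} τ k ≡ con k
    replaceCon-OFree τ k oτ with τ ≟ᵀ T
    ... | yes refl = ⊥-elim (⇛o-¬OFree pargs oτ)
    ... | no _     = refl

    rename-replaceCon : ∀ {Γ Δ} τ k (ρ : Ren Γ Δ) → rename ρ (replaceCon τ k) ≡ replaceCon τ k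
    rename-replaceCon τ k ρ with τ ≟ᵀ T
    ... | yes refl = rename-wk₀ ρ S₀
    ... | no _     = refl

    subst-replaceCon : ∀ {Γ Δ} τ k (θ : Sub Γ Δ) → subst θ (replaceCon τ k) ≡ replaceCon τ k
    subst-replaceCon τ k θ with τ ≟ᵀ T
    ... | yes refl = subst-wk₀ θ S₀
    ... | no _     = refl

    replace-rename : ∀ {Γ Δ τ} (ρ : Ren Γ Δ) (t : Tm Γ τ) →
                     replace (rename ρ t) ≡ rename ρ (replace t)
    replace-rename ρ (var x)         = refl
    replace-rename {τ = τ} ρ (con k) = sym (rename-replaceCon τ k ρ)
    replace-rename ρ (nom a n)       = refl
    replace-rename ρ (lc c)          = refl
    replace-rename ρ (lam t)         = cong lam (replace-rename (liftR ρ) t)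
    replace-rename ρ (app t u)       = cong₂ app (replace-rename ρ t) (replace-rename ρ u)

    replace-subst : ∀ {Γ Δ τ} (θ : Sub Γ Δ) (t : Tm Γ τ) →
                    replace (subst θ t) ≡ subst (replace ∘ θ) (replace t)
    replace-subst θ (var x)         = refl
    replace-subst {τ = τ} θ (con k) = sym (subst-replaceCon τ k (replace ∘ θ))
    replace-subst θ (nom a n)       = refl
    replace-subst θ (lc c)          = refl
    replace-subst θ (lam t)         =
      cong lam (trans (replace-subst (liftS θ) t)
                      (subst-cong (λ { here → refl ; (there x) → replace-rename there (θ x) })
                                  (replace t)))
    replace-subst θ (app t u)       = cong₂ app (replace-subst θ t) (replace-subst θ u)

    ≐-replace : ∀ {Γ τ} {t u : Tm Γ τ} → t ≐ u → replace t ≐ replace u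
    ≐-replace ≐refl        = ≐refl
    ≐-replace (≐sym p)     = ≐sym (≐-replace p)
    ≐-replace (≐trans p q) = ≐trans (≐-replace p) (≐-replace q)
    ≐-replace (≐lam p)     = ≐lam (≐-replace p)
    ≐-replace (≐app p q)   = ≐app (≐-replace p) (≐-replace q)
    ≐-replace (≐β t u)     =
      ≐trans (≐β _ _)
        (≡⇒≐ (sym (trans (replace-subst (sub₀ u) t)
                         (subst-cong (λ { here → refl ; (there x) → refl }) (replace t)))))
    ≐-replace (≐η t)       =
      ≐trans (≐η _) (≐lam (≐app (≡⇒≐ (sym (replace-rename there t))) ≐refl))

    replace-apps-con : ∀ {Γ} (k : K T) (us : TmArgs Γ pargs) →
                       replace (apps (con k) us) ≡ apps (wk₀ S₀) (replaceArgs us)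
    replace-apps-con k us = trans (replace-apps (con k) us) (cong (λ f → apps f (replaceArgs us)) (replaceCon-T k))
      where
        replace-apps : ∀ {Γ as τ} (f : Tm Γ (as ⇛ τ)) (ts : TmArgs Γ as) →
                       replace (apps f ts) ≡ apps (replace f) (replaceArgs ts)
        replace-apps f []       = refl
        replace-apps f (t ∷ ts) = replace-apps (app f t) ts

    OccN-replace : ∀ {Γ τ} c (t : Tm Γ τ) → OccN c (replace t) → OccN c t
    OccN-replace {τ = τ} c (con k) oc with τ ≟ᵀ T
    ... | yes refl = ⊥-elim (proj₂ (proj₂ S-nomFree) c (OccN-rename (λ ()) c S₀ oc))
    ... | no _     = oc
    OccN-replace c (nom a n) oc        = oc
    OccN-replace c (lam t)   oc        = OccN-replace c t oc
    OccN-replace c (app t u) (inj₁ oc) = inj₁ (OccN-replace c t oc)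
    OccN-replace c (app t u) (inj₂ oc) = inj₂ (OccN-replace c u oc)

    -- A neutral term either has a logical constant at its head, and then its type ends in o,
    -- or only o-free arguments.
    replace-normal  : ∀ {Γ τ} → OFreeCtx Γ → (t : Tm Γ τ) → Normal t → OFree τ → replace t ≡ t
    replace-neutral : ∀ {Γ τ} → OFreeCtx Γ → (t : Tm Γ τ) → Neutral t →
                      (ArgsOFree τ × (OFree τ → replace t ≡ t)) ⊎ EndsInO τ
    replace-neutral h (var x)   _ = inj₁ (OFree⇒ArgsOFree _ (h x) , λ _ → refl)
    replace-neutral {τ = τ} h (con k) _ = inj₁ (K-args k , replaceCon-OFree τ k)
    replace-neutral h (nom a n) _ = inj₁ (OFree⇒ArgsOFree _ (OFree-⌜⌝ a) , λ _ → refl)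
    replace-neutral h (lc top)        _ = inj₂ tt
    replace-neutral h (lc bot)        _ = inj₂ tt
    replace-neutral h (lc and)        _ = inj₂ tt
    replace-neutral h (lc or)         _ = inj₂ tt
    replace-neutral h (lc imp)        _ = inj₂ tt
    replace-neutral h (lc (all a))    _ = inj₂ tt
    replace-neutral h (lc (ex a))     _ = inj₂ tt
    replace-neutral h (lc (nab a))    _ = inj₂ tt
    replace-neutral h (lc (nabs as τ)) _ = inj₂ tt
    replace-neutral h (app f a) ((nlf , nf , na) , _) with replace-neutral h f (nf , nlf)
    ... | inj₁ ((oσ , aτ) , fixes) =
      inj₁ (aτ , λ oτ → cong₂ app (fixes (oσ , oτ)) (replace-normal h a na oσ))
    ... | inj₂ e = inj₂ e

    replace-normal h (lam t) n (oσ , oτ) =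
      cong lam (replace-normal (λ { here → oσ ; (there x) → h x }) t n oτ)
    replace-normal h (var x)   _ _ = refl
    replace-normal {τ = τ} h (con k) _ oτ = replaceCon-OFree τ k oτ
    replace-normal h (nom a m) _ _ = refl
    replace-normal {τ = τ} h (lc c) n oτ with replace-neutral h (lc c) (n , tt)
    ... | inj₁ (_ , fixes) = fixes oτ
    ... | inj₂ e           = ⊥-elim (EndsInO⇒¬OFree τ e oτ)
    replace-normal {τ = τ} h (app t u) n oτ with replace-neutral h (app t u) (n , tt)
    ... | inj₁ (_ , fixes) = fixes oτ
    ... | inj₂ e           = ⊥-elim (EndsInO⇒¬OFree τ e oτ)

    replace-≐-OFree : ∀ {Γ τ} → OFreeCtx Γ → OFree τ → (u : Tm Γ τ) → replace u ≐ u
    replace-≐-OFree h oτ u with normalisable u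
    ... | n , normal , u≐n =
      ≐trans (≐-replace u≐n) (≐trans (≡⇒≐ (replace-normal h n normal oτ)) (≐sym u≐n))

    replaceArgs-≐ᴬ : ∀ {Γ as} → OFreeCtx Γ → (us : TmArgs Γ as) → replaceArgs us ≐ᴬ us
    replaceArgs-≐ᴬ h []                  = tt
    replaceArgs-≐ᴬ h (_∷_ {x = a} u us) = replace-≐-OFree h (OFree-⌜⌝ a) u , replaceArgs-≐ᴬ h us

    S-apps≐replace : ∀ {Γ} → OFreeCtx Γ → (k : K T) (us : TmArgs Γ pargs) →
                     apps (wk₀ S) us ≐ replace (apps (con k) us)
    S-apps≐replace h k us =
      ≐trans (apps-≐ˡ us (≐-rename (λ ()) (proj₁ (proj₂ S-nomFree))))
        (≐trans (apps-≐ʳ (wk₀ S₀) (≐ᴬ-sym (replaceArgs-≐ᴬ h us)))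
                (≡⇒≐ (sym (replace-apps-con k us))))

  -- Supports are defined by quantifying over all convertible terms, so transporting InSupp
  -- along ρ needs a way back that introduces no given nominal constant.
  Retractable : ∀ {Γ Δ} → Ren Γ Δ → Set
  Retractable {Γ} {Δ} ρ = ∀ (c : Nom) → Σ (Sub Δ Γ) λ σ →
    (∀ {τ} (x : Γ ∋ τ) → σ (ρ x) ≡ var x) × (∀ {τ} (y : Δ ∋ τ) → ¬ OccN c (σ y))

  Retractable-[] : ∀ (Σ' : List ITy) → Retractable {[]} {⌜ Σ' ⌝ˢ} (λ ())
  Retractable-[] Σ' (b , n) = nomsAt (suc n) , (λ ()) , avoids Σ'
    where
      nomsAt : ∀ {Σ'} → ℕ → Sub ⌜ Σ' ⌝ˢ []
      nomsAt {a ∷ _} m here      = nom a m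
      nomsAt {_ ∷ _} m (there x) = nomsAt m x
      avoids : ∀ Σ' {τ} (y : ⌜ Σ' ⌝ˢ ∋ τ) → ¬ OccN (b , n) (nomsAt (suc n) y)
      avoids (a ∷ Σ') here      e = 1+n≢n (cong proj₂ e)
      avoids (a ∷ Σ') (there y) e = avoids Σ' y e

  Retractable-liftR : ∀ {Γ Δ σ} {ρ : Ren Γ Δ} → Retractable ρ → Retractable (liftR {σ = σ} ρ)
  Retractable-liftR r c with r c
  ... | σ , σ∘ρ≗var , avoids =
    liftS σ , (λ { here → refl ; (there x) → cong wk (σ∘ρ≗var x) }) ,
    (λ { here () ; (there y) oc → avoids y (OccN-rename there c (σ y) oc) })

  InSupp-rename : ∀ {Γ Δ τ} {ρ : Ren Γ Δ} → Retractable ρ → ∀ c (t : Tm Γ τ) →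
                  InSupp c t → InSupp c (rename ρ t)
  InSupp-rename {ρ = ρ} r c t c∈t t' ρt≐t' with r c
  ... | σ , σ∘ρ≗var , avoids
      with OccN-subst σ c t'
             (c∈t (subst σ t')
                  (≐trans (≡⇒≐ (sym (trans (subst-rename σ ρ t)
                                           (trans (subst-cong σ∘ρ≗var t) (subst-var t)))))
                          (≐-subst σ ρt≐t')))
  ... | inj₁ oc          = oc
  ... | inj₂ (_ , y , oc) = ⊥-elim (avoids y oc)

  Fresh-rename : ∀ {Γ Δ τ} (ρ : Ren Γ Δ) c {t : Tm Γ τ} → Fresh c t → Fresh c (rename ρ t)
  Fresh-rename ρ c (t' , t≐t' , ¬oc) =
    rename ρ t' , ≐-rename ρ t≐t' , λ oc → ¬oc (OccN-rename ρ c t' oc)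

  ListsSupp-rename : ∀ {Γ Δ τ} {ρ : Ren Γ Δ} → Retractable ρ → ∀ cs {t : Tm Γ τ} →
                     ListsSupp cs t → ListsSupp cs (rename ρ t)
  ListsSupp-rename {ρ = ρ} r cs {t} (unique , inSupp , t' , t≐t' , occ⇒∈) =
    unique , (λ c c∈cs → InSupp-rename r c t (inSupp c c∈cs)) ,
    rename ρ t' , ≐-rename ρ t≐t' , λ c oc → occ⇒∈ c (OccN-rename ρ c t' oc)

  Raise-rename : ∀ {Σ₁ Σ₂ Σ₃ τ} (ρ : Ren ⌜ Σ₁ ⌝ˢ ⌜ Σ₂ ⌝ˢ) → Retractable ρ → (θ : ESub Σ₂ Σ₃)
                 {B : Tm ⌜ Σ₁ ⌝ˢ τ} {B' : Tm ⌜ Σ₃ ⌝ˢ τ} → Raise θ (rename ρ B) B' → Raise (θ ∘ ρ) B B'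
  Raise-rename ρ r θ {B} (π , admissible , B'≡) =
    π , (λ c c∈B x → admissible c (InSupp-rename r c B c∈B) (ρ x)) ,
    trans B'≡ (trans (cong (subst θ) (perm-rename π ρ B)) (subst-rename θ ρ (π · B)))

  Raises-rename : ∀ {Σ₁ Σ₂ Σ₃} (ρ : Ren ⌜ Σ₁ ⌝ˢ ⌜ Σ₂ ⌝ˢ) → Retractable ρ → (θ : ESub Σ₂ Σ₃)
                  {Γ : List (Form Σ₁)} {Γ' : List (Form Σ₃)} →
                  Pointwise (Raise θ) (map (rename ρ) Γ) Γ' → Pointwise (Raise (θ ∘ ρ)) Γ Γ'
  Raises-rename ρ r θ {[]}    {[]}    []       = []
  Raises-rename ρ r θ {_ ∷ _} {_ ∷ _} (x ∷ xs) = Raise-rename ρ r θ x ∷ Raises-rename ρ r θ xs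

  Solution-rename : ∀ {Σ₁ Σ₂ Σ₃ as τ} (ρ : Ren ⌜ Σ₁ ⌝ˢ ⌜ Σ₂ ⌝ˢ) → Retractable ρ → (θ : ESub Σ₂ Σ₃)
                    {s : Tm ⌜ Σ₁ ⌝ˢ (as ⇛ τ)} {t : Tm ⌜ Σ₁ ⌝ˢ τ} →
                    Solution θ (rename ρ s) (rename ρ t) → Solution (θ ∘ ρ) s t
  Solution-rename {as = as} ρ r θ {s} {t} (π , admissible , holds) =
    π , (λ c c∈s⊵t x → admissible c (InSupp-rename r c (s ⊵ t) c∈s⊵t) (ρ x)) ,
    transport (λ st → Holds as (proj₁ st) (proj₂ st))
      (cong₂ _,_ (trans (cong (subst θ) (perm-rename π ρ s)) (subst-rename θ ρ (π · s)))
                 (trans (cong (subst θ) (perm-rename π ρ t)) (subst-rename θ ρ (π · t))))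
      holds

  Holds-rename : ∀ {Γ Δ as τ} (ρ : Ren Γ Δ) {s : Tm Γ (as ⇛ τ)} {t : Tm Γ τ} →
                 Holds as s t → Holds as (rename ρ s) (rename ρ t)
  Holds-rename {as = as} ρ (ns , unique , t' , fresh , s≐ , t≐) =
    ns , unique , rename (liftExt as ρ) t' ,
    (λ c c∈ oc → fresh c c∈ (OccN-rename (liftExt as ρ) c t' oc)) ,
    ≐trans (≐-rename ρ s≐) (≡⇒≐ (rename-lams as ρ t')) ,
    ≐trans (≐-rename ρ t≐) (≡⇒≐ (rename-inst as ρ ns t'))

  map-rename-wkF : ∀ {Σ₁ Σ₂ h} (ρ : Ren ⌜ Σ₁ ⌝ˢ ⌜ Σ₂ ⌝ˢ) (Γ : List (Form Σ₁)) →
                   map (rename (liftR {σ = ⌜ h ⌝} ρ)) (map wkF Γ) ≡ map wkF (map (rename ρ) Γ)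
  map-rename-wkF ρ []      = refl
  map-rename-wkF ρ (B ∷ Γ) = cong₂ _∷_ (rename-wk ρ B) (map-rename-wkF ρ Γ)

  rename-apps-wk₀ : ∀ {Γ Δ as} (ρ : Ren Γ Δ) (S : Tm [] (as ⇛ o)) (ts : TmArgs Γ as) →
                    rename ρ (apps (wk₀ S) ts) ≡ apps (wk₀ S) (renameArgs ρ ts)
  rename-apps-wk₀ ρ S ts = trans (rename-apps ρ (wk₀ S) ts) (cong (λ f → apps f (renameArgs ρ ts)) (rename-wk₀ ρ S))

  rename-bApp : ∀ {Γ Δ} (ρ : Ren Γ Δ) (c : Clause) (q : Tm Γ (args c ⇛ o)) ts →
                rename ρ (bApp c q ts) ≡ bApp c (rename ρ q) (renameArgs ρ ts)
  rename-bApp ρ c q ts =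
    trans (rename-apps ρ _ ts) (cong (λ f → apps (app f (rename ρ q)) (renameArgs ρ ts)) (rename-wk₀ ρ (body c)))

  module Derivations (D : List Clause) where

    castSeq : ∀ {Σ' Γ Γ' C C'} → Γ ≡ Γ' → C ≡ C' → Seq D Σ' Γ C → Seq D Σ' Γ' C'
    castSeq refl refl d = d

    castHyp : ∀ {Σ' Γ A A' C} → A ≡ A' → Seq D Σ' (A ∷ Γ) C → Seq D Σ' (A' ∷ Γ) C
    castHyp refl d = d

    ≐-refl-pointwise : ∀ {Γ} (Fs : List (Tm Γ o)) → Pointwise _≐_ Fs Fs
    ≐-refl-pointwise []       = []
    ≐-refl-pointwise (F ∷ Fs) = ≐refl ∷ ≐-refl-pointwise Fs

    convHyp : ∀ {Σ' Γ} {A A' : Form Σ'} {C} → A ≐ A' → Seq D Σ' (A' ∷ Γ) C → Seq D Σ' (A ∷ Γ) C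
    convHyp {Γ = Γ} p = conv (p ∷ ≐-refl-pointwise Γ) ≐refl

    convGoal : ∀ {Σ' Γ} {C C' : Form Σ'} → C ≐ C' → Seq D Σ' Γ C' → Seq D Σ' Γ C
    convGoal {Γ = Γ} = conv (≐-refl-pointwise Γ)

    renameSeq : ∀ {Σ₁ Σ₂ Γ C} (ρ : Ren ⌜ Σ₁ ⌝ˢ ⌜ Σ₂ ⌝ˢ) → Retractable ρ → Seq D Σ₁ Γ C →
                Seq D Σ₂ (map (rename ρ) Γ) (rename ρ C)
    renameSeq ρ r (exch Γ↭Γ' d)  = exch (↭.map⁺ (rename ρ) Γ↭Γ') (renameSeq ρ r d)
    renameSeq ρ r (conv ps p d)  = conv (pointwise ps) (≐-rename ρ p) (renameSeq ρ r d)
      where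
        pointwise : ∀ {Fs Gs} → Pointwise _≐_ Fs Gs → Pointwise _≐_ (map (rename ρ) Fs) (map (rename ρ) Gs)
        pointwise []       = []
        pointwise (q ∷ qs) = ≐-rename ρ q ∷ pointwise qs
    renameSeq ρ r (id {B' = B'} (π , p)) =
      id (π , ≐trans (≐-rename ρ p) (≡⇒≐ (sym (perm-rename π ρ B'))))
    renameSeq ρ r (cut {Γ = Γ} {Δ} d d') =
      castSeq (sym (map-++ (rename ρ) Γ Δ)) refl (cut (renameSeq ρ r d) (renameSeq ρ r d'))
    renameSeq ρ r (cL d)      = cL (renameSeq ρ r d)
    renameSeq ρ r ⊥L          = ⊥L
    renameSeq ρ r ⊤R          = ⊤R
    renameSeq ρ r (∨L d d')   = ∨L (renameSeq ρ r d) (renameSeq ρ r d')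
    renameSeq ρ r (∨R₁ d)     = ∨R₁ (renameSeq ρ r d)
    renameSeq ρ r (∨R₂ d)     = ∨R₂ (renameSeq ρ r d)
    renameSeq ρ r (∧L₁ d)     = ∧L₁ (renameSeq ρ r d)
    renameSeq ρ r (∧L₂ d)     = ∧L₂ (renameSeq ρ r d)
    renameSeq ρ r (∧R d d')   = ∧R (renameSeq ρ r d) (renameSeq ρ r d')
    renameSeq ρ r (⊃L d d')   = ⊃L (renameSeq ρ r d) (renameSeq ρ r d')
    renameSeq ρ r (⊃R d)      = ⊃R (renameSeq ρ r d)
    renameSeq ρ r (∀L t d)    = ∀L (rename ρ t) (renameSeq ρ r d)
    renameSeq ρ r (∃R t d)    = ∃R (rename ρ t) (renameSeq ρ r d)
    renameSeq ρ r (∀R {Γ = Γ} {P = P} cs ls d) =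
      ∀R cs (ListsSupp-rename r cs ls)
        (castSeq (map-rename-wkF ρ Γ)
                 (cong₂ app (rename-wk ρ P) (rename-hApp cs (liftR ρ) (var here)))
                 (renameSeq (liftR ρ) (Retractable-liftR r) d))
    renameSeq ρ r (∃L {Γ = Γ} {P = P} {C} cs ls d) =
      ∃L cs (ListsSupp-rename r cs ls)
        (castSeq (cong₂ _∷_ (cong₂ app (rename-wk ρ P) (rename-hApp cs (liftR ρ) (var here)))
                            (map-rename-wkF ρ Γ))
                 (rename-wk ρ C)
                 (renameSeq (liftR ρ) (Retractable-liftR r) d))
    renameSeq ρ r (∇L n fresh d) = ∇L n (Fresh-rename ρ _ fresh) (renameSeq ρ r d)
    renameSeq ρ r (∇R n fresh d) = ∇R n (Fresh-rename ρ _ fresh) (renameSeq ρ r d)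
    renameSeq ρ r (⊵L k) = ⊵L λ Σ₃ θ solution Γ' C' raisesΓ raiseC →
      k Σ₃ (θ ∘ ρ) (Solution-rename ρ r θ solution) Γ' C'
        (Raises-rename ρ r θ raisesΓ) (Raise-rename ρ r θ raiseC)
    renameSeq ρ r (⊵R holds) = ⊵R (Holds-rename ρ holds)
    renameSeq ρ r (defL c m ts d) =
      castHyp (sym (rename-apps ρ (con (pred c)) ts))
        (defL c m (renameArgs ρ ts) (castHyp (rename-bApp ρ c _ ts) (renameSeq ρ r d)))
    renameSeq ρ r (defR c m ts d) =
      castSeq refl (sym (rename-apps ρ (con (pred c)) ts))
        (defR c m (renameArgs ρ ts) (castSeq refl (rename-bApp ρ c _ ts) (renameSeq ρ r d)))
    renameSeq ρ r (IL c m isInd S nf ts d₁ d₂) =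
      castHyp (sym (rename-apps ρ (con (pred c)) ts))
        (IL c m isInd S nf (renameArgs ρ ts) d₁ (castHyp (rename-apps-wk₀ ρ S ts) (renameSeq ρ r d₂)))
    renameSeq ρ r (CIR c m isCoind S nf ts d₁ d₂) =
      castSeq refl (sym (rename-apps ρ (con (pred c)) ts))
        (CIR c m isCoind S nf (renameArgs ρ ts)
             (castSeq refl (rename-apps-wk₀ ρ S ts) (renameSeq ρ r d₁)) d₂)

    wkF* : ∀ as {Σ'} → Form Σ' → Form (extI as Σ')
    wkF* []       C = C
    wkF* (a ∷ as) C = wkF* as (wkF C)

    wkF*-rename : ∀ as {Σ'} (C : Form Σ') → wkF* as C ≡ rename (toExt as Σ' ∘ extWk as) C
    wkF*-rename []       C = sym (rename-id C)
    wkF*-rename (a ∷ as) C = trans (wkF*-rename as (wkF C)) (rename-∘ _ there C)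

    ∃*L : ∀ as {Σ'} (Φ : Tm (ext as ⌜ Σ' ⌝ˢ) o) {C : Form Σ'} → NomFree Φ →
          Seq D (extI as Σ') (rename (toExt as Σ') Φ ∷ []) (wkF* as C) → Seq D Σ' (∃* as Φ ∷ []) C
    ∃*L []       Φ h d = castHyp (rename-id Φ) d
    ∃*L (a ∷ as) Φ h d =
      ∃L [] (NomFree⇒ListsSupp[] (NomFree-lam (NomFree-∃* as h)))
        (convHyp (β-wk-here (∃* as Φ)) (∃*L as Φ h d))

    ∀*R : ∀ as {Σ'} (Φ : Tm (ext as ⌜ Σ' ⌝ˢ) o) → NomFree Φ →
          Seq D (extI as Σ') [] (rename (toExt as Σ') Φ) → Seq D Σ' [] (∀* as Φ)
    ∀*R []       Φ h d = castSeq refl (rename-id Φ) d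
    ∀*R (a ∷ as) Φ h d =
      ∀R [] (NomFree⇒ListsSupp[] (NomFree-lam (NomFree-∀* as h)))
        (convGoal (β-wk-here (∀* as Φ)) (∀*R as Φ h d))

    ∀*L : ∀ as {Σ' Γ C} (Φ : Tm (ext as ⌜ Σ' ⌝ˢ) o) (us : TmArgs ⌜ Σ' ⌝ˢ as) →
          Seq D Σ' (subst (extS as var us) Φ ∷ Γ) C → Seq D Σ' (∀* as Φ ∷ Γ) C
    ∀*L []       Φ []       d = castHyp (subst-var Φ) d
    ∀*L (a ∷ as) Φ (u ∷ us) d =
      ∀L u (convHyp (≐trans (≐β _ _) (≡⇒≐ (subst-∀* as (sub₀ u) Φ)))
                    (∀*L as (subst (liftExtS as (sub₀ u)) Φ) us (castHyp instantiate d)))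
      where
        instantiate : subst (extS (a ∷ as) var (u ∷ us)) Φ
                    ≡ subst (extS as var us) (subst (liftExtS as (sub₀ u)) Φ)
        instantiate =
          sym (trans (subst-subst (extS as var us) (liftExtS as (sub₀ u)) Φ)
                     (subst-cong (λ v → trans (extS-liftExtS as var (sub₀ u) us v)
                                              (extS-cong as us (λ { here → subst-var u
                                                                  ; (there y) → refl }) v)) Φ))

    ∇*-≐ : ∀ as {Γ} {F G : Tm (ext as Γ) o} → F ≐ G → ∇* as F ≐ ∇* as G
    ∇*-≐ []       p = p
    ∇*-≐ (a ∷ as) p = ≐app ≐refl (≐lam (∇*-≐ as p))

    -- F₀ is a representative of F in which the chosen nominal constants visibly do not occur.
    ∇*L : ∀ as {Σ' Δ C} (F : Tm (ext as ⌜ Σ' ⌝ˢ) o) ns → Unique (noms as ns) →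
          (F₀ : Tm (ext as ⌜ Σ' ⌝ˢ) o) → F ≐ F₀ → (∀ c → c ∈ noms as ns → ¬ OccN c F₀) →
          Seq D Σ' (inst as ns F ∷ Δ) C → Seq D Σ' (∇* as F ∷ Δ) C
    ∇*L []       F []       _          F₀ _    _     d = d
    ∇*L (a ∷ as) F (n ∷ ns) (n∉ ∷ uniq) F₀ F≐F₀ fresh d =
      ∇L n (lam (∇* as F₀) , ≐lam (∇*-≐ as F≐F₀) ,
            λ oc → fresh (a , n) (here refl) (OccN-∇* as _ F₀ oc))
        (convHyp (≐trans (≐β _ _) (≡⇒≐ (subst-∇* as (sub₀ (nom a n)) F)))
          (∇*L as (subst σ F) ns uniq (subst σ F₀) (≐-subst σ F≐F₀) fresh'
            (castHyp (sym (inst-liftExtS as (sub₀ (nom a n)) ns F)) d)))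
      where
        σ : Sub (ext as (⌜ a ⌝ ∷ ⌜ _ ⌝ˢ)) (ext as ⌜ _ ⌝ˢ)
        σ = liftExtS as (sub₀ (nom a n))
        fresh' : ∀ c → c ∈ noms as ns → ¬ OccN c (subst σ F₀)
        fresh' c c∈ oc =
          [ fresh c (there c∈)
          , (λ { (_ , x , oc') → All.lookup n∉ c∈ (OccN-liftExtS-sub₀ as a n c x oc') }) ]
          (OccN-subst σ c F₀ oc)

    ⋁L : ∀ {Σ' Γ C} (Fs : List (Form Σ')) → (∀ {F} → F ∈ Fs → Seq D Σ' (F ∷ Γ) C) →
         Seq D Σ' (⋁ Fs ∷ Γ) C
    ⋁L []           _ = ⊥L
    ⋁L (F ∷ [])     d = d (here refl)
    ⋁L (F ∷ G ∷ Fs) d = ∨L (d (here refl)) (⋁L (G ∷ Fs) (d ∘ there))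

  ≐-setoid : ∀ {Γ τ} → Setoid _ _
  ≐-setoid {Γ} {τ} = record
    { Carrier       = Tm Γ τ
    ; _≈_           = _≐_
    ; isEquivalence = record { refl = ≐refl ; sym = ≐sym ; trans = ≐trans } }

  module ≐-Reasoning {Γ τ} = SetoidReasoning (≐-setoid {Γ} {τ})

  Raise-NomFree : ∀ {Σ₁ Σ₂ τ} {θ : ESub Σ₁ Σ₂} {B : Tm ⌜ Σ₁ ⌝ˢ τ} {B'} →
                  NomFree B → Raise θ B B' → B' ≐ subst θ B
  Raise-NomFree {θ = θ} nf (π , _ , refl) = ≐-subst θ (perm-NomFree π nf)

  Holds-≐ : ∀ {Γ as τ} {s s' : Tm Γ (as ⇛ τ)} {t t' : Tm Γ τ} →
            s ≐ s' → t ≐ t' → Holds as s t → Holds as s' t'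
  Holds-≐ s≐s' t≐t' (ns , uniq , t₀ , fresh , s≐ , t≐) =
    ns , uniq , t₀ , fresh , ≐trans (≐sym s≐s') s≐ , ≐trans (≐sym t≐t') t≐

  Solution-NomFree : ∀ {Σ₁ Σ₂ as τ} {θ : ESub Σ₁ Σ₂} {s : Tm ⌜ Σ₁ ⌝ˢ (as ⇛ τ)} {t} →
                     NomFree s → NomFree t → Solution θ s t → Holds as (subst θ s) (subst θ t)
  Solution-NomFree {θ = θ} nfs nft (π , _ , holds) =
    Holds-≐ (≐-subst θ (perm-NomFree π nfs)) (≐-subst θ (perm-NomFree π nft)) holds

  module InductionOnPatterns (D : List Clause) (pargs : List ITy) (p' : K (pargs ⇛ o))
                             (S : Tm [] (pargs ⇛ o)) (S-nomFree : NomFree S) where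
    open Derivations D
    open Replacement pargs S S-nomFree

    S∙ : ∀ {Γ} → TmArgs Γ pargs → Tm Γ o
    S∙ = apps (wk₀ S)

    ∇*S⊢S : ∀ {Σ' Δ} zs (k : K T) (us : TmArgs (ext zs ⌜ Σ' ⌝ˢ) pargs) (vs : TmArgs ⌜ Σ' ⌝ˢ pargs) →
            Holds zs (lams zs (apps (con k) us)) (apps (con k) vs) →
            Seq D Σ' (∇* zs (S∙ us) ∷ Δ) (S∙ vs)
    ∇*S⊢S {Σ'} zs k us vs (ns , uniq , t₀ , fresh , s≐ , t≐) =
      ∇*L zs (S∙ us) ns uniq (replace t₀) Sus≐
          (λ c c∈ oc → fresh c c∈ (OccN-replace c t₀ oc)) (id (≐⇒≈ instance≐))
      where
        open ≐-Reasoning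
        kus≐t₀ : apps (con k) us ≐ t₀
        kus≐t₀ = lams-injective zs s≐
        Sus≐ : S∙ us ≐ replace t₀
        Sus≐ = ≐trans (S-apps≐replace (OFreeCtx-ext zs (OFreeCtx-⌜⌝ˢ Σ')) k us) (≐-replace kus≐t₀)
        us' : TmArgs ⌜ Σ' ⌝ˢ pargs
        us' = instArgs zs ns us
        instance≐ : inst zs ns (S∙ us) ≐ S∙ vs
        instance≐ = begin
          inst zs ns (S∙ us)
            ≡⟨ trans (inst-apps zs ns (wk₀ S) us) (cong (λ f → apps f us') (inst-wk₀ zs ns S)) ⟩
          S∙ us'
            ≈⟨ S-apps≐replace (OFreeCtx-⌜⌝ˢ Σ') k us' ⟩
          replace (apps (con k) us')
            ≡⟨ cong replace (sym (trans (inst-apps zs ns (con k) us)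
                                        (cong (λ f → apps f us') (inst-con zs ns k)))) ⟩
          replace (inst zs ns (apps (con k) us))
            ≈⟨ ≐-replace (≐trans (≐-inst zs ns kus≐t₀) (≐sym t≐)) ⟩
          replace (apps (con k) vs)
            ≈⟨ S-apps≐replace (OFreeCtx-⌜⌝ˢ Σ') k vs ⟨
          S∙ vs ∎

    Y : List ITy
    Y = xCtx pargs

    ys : TmArgs ⌜ Y ⌝ˢ pargs
    ys = xVars pargs

    -- the instance of the translated body in the premise of IL: P ↦ S, y⃗ ↦ y⃗
    P↦S : Sub (T ∷ []) ⌜ Y ⌝ˢ
    P↦S = ∅ˢ ,, wk₀ S

    Θ : Sub (ext pargs (T ∷ [])) ⌜ Y ⌝ˢ
    Θ = extS pargs P↦S ys

    Θ-nomFree : NomFreeˢ Θ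
    Θ-nomFree =
      NomFreeˢ-extS pargs ys (λ { here → NomFree-wk₀ S-nomFree })
        (ArgsNomFree-renameArgs (toExt pargs []) (extVars pargs []) (ArgsNomFree-extVars pargs []))

    module PatternClause (xs zs : List ITy) (ts : TmArgs (ext zs (ext xs [])) pargs)
                         (B : Tm [] ((pargs ⇛ o) ⇒ (xs ⇛ o)))
                         (B-nomFree : NomFree B) (ts-nomFree : ArgsNomFree ts) where

      B∙S : ∀ {Γ} → TmArgs Γ xs → Tm Γ o
      B∙S = apps (app (wk₀ B) (wk₀ S))

      premiseFormula : Tm (ext xs []) o
      premiseFormula = B∙S (extVars xs []) ⊃̇ ∇* zs (S∙ ts)

      premise-closed : ILpPremise D S (pclause xs zs ts B) → Seq D [] [] (∀* xs premiseFormula)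
      premise-closed premise =
        ∀*R xs premiseFormula premiseFormula-nomFree (castSeq refl (sym renamed) (⊃R premise))
        where
          premiseFormula-nomFree : NomFree premiseFormula
          premiseFormula-nomFree =
            NomFree-app (NomFree-app (NomFree-lc _)
                           (NomFree-apps _ (NomFree-app (NomFree-wk₀ B-nomFree) (NomFree-wk₀ S-nomFree))
                                         (ArgsNomFree-extVars xs [])))
                        (NomFree-∇* zs (NomFree-apps ts (NomFree-wk₀ S-nomFree) ts-nomFree))
          ρ : Ren (ext zs (ext xs [])) (ext zs ⌜ xCtx xs ⌝ˢ)
          ρ = liftExt zs (toExt xs [])
          renamed : rename (toExt xs []) premiseFormula
                  ≡ (B∙S (xVars xs) ⊃̇ ∇* zs (S∙ (renameArgs ρ ts)))
          renamed =
            cong₂ _⊃̇_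
              (trans (rename-apps (toExt xs []) _ (extVars xs []))
                     (cong₂ (λ f g → apps (app f g) (xVars xs)) (rename-wk₀ _ B) (rename-wk₀ _ S)))
              (trans (rename-∇* zs (toExt xs []) _)
                     (cong (∇* zs) (rename-apps-wk₀ ρ S ts)))

      clause-instance : ∀ {Σ'} (k : K T) (us : TmArgs ⌜ Σ' ⌝ˢ xs) (vs : TmArgs ⌜ Σ' ⌝ˢ pargs) →
                        Seq D [] [] (∀* xs premiseFormula) →
                        Holds zs (lams zs (apps (con k) (substArgs (liftExtS zs (extS xs ∅ˢ us)) ts)))
                                 (apps (con k) vs) →
                        Seq D Σ' (B∙S us ∷ []) (S∙ vs)
      clause-instance {Σ'} k us vs closed holds =
        cut (renameSeq (λ ()) (Retractable-[] Σ') closed)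
          (castHyp (sym (rename-∀* xs (λ ()) premiseFormula))
            (∀*L xs (rename (liftExt xs (λ ())) premiseFormula) us
              (castHyp (sym instantiated) (⊃L (id (≐⇒≈ ≐refl)) (∇*S⊢S zs k (substArgs (liftExtS zs Λ) ts) vs holds)))))
        where
          Λ : Sub (ext xs []) ⌜ Σ' ⌝ˢ
          Λ = extS xs ∅ˢ us
          instantiated : subst (extS xs var us) (rename (liftExt xs (λ ())) premiseFormula)
                       ≡ (B∙S us ⊃̇ ∇* zs (S∙ (substArgs (liftExtS zs Λ) ts)))
          instantiated =
            trans (subst-rename (extS xs var us) (liftExt xs (λ ())) premiseFormula)
              (trans (subst-cong (λ v → trans (extS-liftExt xs var (λ ()) us v)
                                              (extS-cong xs us (λ ()) v)) premiseFormula)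
                (cong₂ _⊃̇_
                  (trans (subst-apps Λ _ (extVars xs []))
                    (cong₂ (λ f us' → apps f us')
                           (cong₂ app (subst-wk₀ Λ B) (subst-wk₀ Λ S)) (extS-extVars xs ∅ˢ us)))
                  (trans (subst-∇* zs Λ _)
                    (cong (∇* zs) (trans (subst-apps (liftExtS zs Λ) (wk₀ S) ts)
                                         (cong (λ f → apps f (substArgs (liftExtS zs Λ) ts)) (subst-wk₀ (liftExtS zs Λ) S)))))))

      -- The disjunct ∃x⃗.((λz⃗. p' t⃗) ⊵ p' y⃗) ∧ B P x⃗ of the translated body, in the context
      -- P, y⃗, x⃗ of its matrix.
      Γᵇ : List Ty
      Γᵇ = ext pargs (T ∷ [])

      tsᵀ : TmArgs (ext zs (ext xs Γᵇ)) pargs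
      tsᵀ = renameArgs (liftExt zs (liftExt xs (λ ()))) ts

      ysᵀ : TmArgs (ext xs Γᵇ) pargs
      ysᵀ = renameArgs (extWk xs) (extVars pargs (T ∷ []))

      sᵀ : Tm (ext xs Γᵇ) (zs ⇛ o)
      sᵀ = lams zs (apps (con p') tsᵀ)

      tᵀ : Tm (ext xs Γᵇ) o
      tᵀ = apps (con p') ysᵀ

      Bᵀ : Tm (ext xs Γᵇ) o
      Bᵀ = apps (app (wk₀ B) (rename (extWk xs) (rename (extWk pargs) (var here)))) (extVars xs Γᵇ)

      Σˣ : List ITy
      Σˣ = extI xs Y

      wkˣ : Ren ⌜ Y ⌝ˢ ⌜ Σˣ ⌝ˢ
      wkˣ = toExt xs Y ∘ extWk xs

      Θˣ : Sub (ext xs Γᵇ) ⌜ Σˣ ⌝ˢ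
      Θˣ = rename (toExt xs Y) ∘ liftExtS xs Θ

      Θˣ-extWk : ∀ {τ} (v : Γᵇ ∋ τ) → Θˣ (extWk xs v) ≡ rename wkˣ (Θ v)
      Θˣ-extWk v =
        trans (cong (rename (toExt xs Y)) (liftExtS-extWk xs Θ v)) (rename-∘ (toExt xs Y) (extWk xs) (Θ v))

      Θˣ-nomFree : NomFreeˢ Θˣ
      Θˣ-nomFree x = NomFree-rename (toExt xs Y) (NomFreeˢ-liftExtS xs Θ-nomFree x)

      sᵀ-nomFree : NomFree sᵀ
      sᵀ-nomFree = NomFree-lams zs (NomFree-apps _ (NomFree-con p') (ArgsNomFree-renameArgs _ ts ts-nomFree))

      tᵀ-nomFree : NomFree tᵀ
      tᵀ-nomFree =
        NomFree-apps _ (NomFree-con p') (ArgsNomFree-renameArgs _ _ (ArgsNomFree-extVars pargs _))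

      Bᵀ-nomFree : NomFree Bᵀ
      Bᵀ-nomFree = NomFree-apps _ (NomFree-app (NomFree-wk₀ B-nomFree) (NomFree-var _))
                                  (ArgsNomFree-extVars xs _)

      module Instance {Σ''} (θ : ESub Σˣ Σ'') where

        xsᶿ : TmArgs ⌜ Σ'' ⌝ˢ xs
        xsᶿ = substArgs (subst θ ∘ Θˣ) (extVars xs Γᵇ)

        ysᶿ : TmArgs ⌜ Σ'' ⌝ˢ pargs
        ysᶿ = substArgs (θ ∘ wkˣ) ys

        Bᵀ-instance : subst θ (subst Θˣ Bᵀ) ≡ B∙S xsᶿ
        Bᵀ-instance =
          trans (subst-subst θ Θˣ Bᵀ)
            (trans (subst-apps (subst θ ∘ Θˣ) _ (extVars xs Γᵇ))
              (cong (λ f → apps f xsᶿ)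
                (cong₂ app (subst-wk₀ _ B)
                  (trans (cong (subst θ) (Θˣ-extWk (extWk pargs here)))
                    (trans (cong (λ t → subst θ (rename wkˣ t)) (extS-extWk pargs P↦S ys here))
                      (trans (cong (subst θ) (rename-wk₀ wkˣ S)) (subst-wk₀ θ S)))))))

        tᵀ-instance : subst θ (subst Θˣ tᵀ) ≡ apps (con p') ysᶿ
        tᵀ-instance =
          trans (subst-subst θ Θˣ tᵀ)
            (trans (subst-apps (subst θ ∘ Θˣ) (con p') ysᵀ)
              (cong (apps (con p'))
                (trans (substArgs-renameArgs (subst θ ∘ Θˣ) (extWk xs) (extVars pargs (T ∷ [])))
                  (trans (substArgs-cong (λ v → trans (cong (subst θ) (Θˣ-extWk v))
                                                      (subst-rename θ wkˣ (Θ v)))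
                                         (extVars pargs (T ∷ [])))
                    (trans (sym (substArgs-substArgs (θ ∘ wkˣ) Θ (extVars pargs (T ∷ []))))
                           (cong (substArgs (θ ∘ wkˣ)) (extS-extVars pargs P↦S ys)))))))

        sᵀ-instance : subst θ (subst Θˣ sᵀ)
                    ≡ lams zs (apps (con p') (substArgs (liftExtS zs (extS xs ∅ˢ xsᶿ)) ts))
        sᵀ-instance =
          trans (subst-subst θ Θˣ sᵀ)
            (trans (subst-lams zs (subst θ ∘ Θˣ) (apps (con p') tsᵀ))
              (cong (lams zs)
                (trans (subst-apps (liftExtS zs (subst θ ∘ Θˣ)) (con p') tsᵀ)
                  (cong (apps (con p'))
                    (trans (substArgs-renameArgs (liftExtS zs (subst θ ∘ Θˣ)) _ ts)
                      (substArgs-cong (λ v → trans (liftExtS-liftExt zs _ ρ v)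
                                                   (liftExtS-cong zs restrict v)) ts))))))
          where
            ρ : Ren (ext xs []) (ext xs Γᵇ)
            ρ = liftExt xs (λ ())
            restrict : (subst θ ∘ Θˣ ∘ ρ) ≗ˢ extS xs ∅ˢ xsᶿ
            restrict v =
              trans (extS-η xs (subst θ ∘ Θˣ ∘ ρ) v)
                (trans (extS-cong xs _ (λ ()) v)
                  (cong (λ us → extS xs ∅ˢ us v)
                    (trans (sym (substArgs-renameArgs (subst θ ∘ Θˣ) ρ (extVars xs [])))
                           (cong (substArgs (subst θ ∘ Θˣ)) (renameArgs-extVars xs {[]} {Γᵇ} (λ ()))))))

        goal-instance : subst θ (wkF* xs (S∙ ys)) ≡ S∙ ysᶿ
        goal-instance =
          trans (cong (subst θ) (wkF*-rename xs (S∙ ys)))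
            (trans (subst-rename θ wkˣ (S∙ ys))
              (trans (subst-apps (θ ∘ wkˣ) (wk₀ S) ys) (cong (λ f → apps f ysᶿ) (subst-wk₀ _ S))))

      disjunct⊢S : Seq D [] [] (∀* xs premiseFormula) →
                   Seq D Y (subst Θ (transDisj p' (pclause xs zs ts B)) ∷ []) (S∙ ys)
      disjunct⊢S closed =
        castHyp (sym (subst-∃* xs Θ matrix))
          (∃*L xs (subst (liftExtS xs Θ) matrix)
               (NomFree-subst matrix-nomFree (NomFreeˢ-liftExtS xs Θ-nomFree))
            (convHyp (≡⇒≐ (rename-subst (toExt xs Y) (liftExtS xs Θ) matrix))
              (cL (∧L₂ (exch (swap _ _ ↭-refl) (∧L₁ (⊵L solution-case)))))))
        where
          matrix : Tm (ext xs Γᵇ) o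
          matrix = (sᵀ ⊵ tᵀ) ∧̇ Bᵀ
          matrix-nomFree : NomFree matrix
          matrix-nomFree = NomFree-app (NomFree-app (NomFree-lc _)
                             (NomFree-app (NomFree-app (NomFree-lc _) sᵀ-nomFree) tᵀ-nomFree)) Bᵀ-nomFree
          goal-nomFree : NomFree (wkF* xs (S∙ ys))
          goal-nomFree =
            transport NomFree (sym (wkF*-rename xs (S∙ ys)))
              (NomFree-rename wkˣ (NomFree-apps ys (NomFree-wk₀ S-nomFree)
                (ArgsNomFree-renameArgs (toExt pargs []) (extVars pargs []) (ArgsNomFree-extVars pargs []))))
          solution-case : ∀ Σ'' (θ : ESub Σˣ Σ'') → Solution θ (subst Θˣ sᵀ) (subst Θˣ tᵀ) →
                          ∀ Γ' C' → Pointwise (Raise θ) (subst Θˣ Bᵀ ∷ []) Γ' →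
                          Raise θ (wkF* xs (S∙ ys)) C' → Seq D Σ'' Γ' C'
          solution-case Σ'' θ solution (B' ∷ []) C' (raiseB ∷ []) raiseC =
            convHyp (≐trans (Raise-NomFree (NomFree-subst Bᵀ-nomFree Θˣ-nomFree) raiseB)
                            (≡⇒≐ Bᵀ-instance))
              (convGoal (≐trans (Raise-NomFree goal-nomFree raiseC) (≡⇒≐ goal-instance))
                (clause-instance p' xsᶿ ysᶿ closed
                  (transport (λ st → Holds zs (proj₁ st) (proj₂ st)) (cong₂ _,_ sᵀ-instance tᵀ-instance)
                    (Solution-NomFree (NomFree-subst sᵀ-nomFree Θˣ-nomFree)
                                      (NomFree-subst tᵀ-nomFree Θˣ-nomFree) solution))))
            where open Instance θ

    translatedBody⊢S : ∀ (p : K (pargs ⇛ o)) (pcs : List (PClause pargs)) →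
                       (∀ {pc} → pc ∈ pcs → NomFree (B pc) × ArgsNomFree (ts pc)) →
                       (∀ {pc} → pc ∈ pcs → ILpPremise D S pc) →
                       Seq D Y (bApp (translate p p' pcs) (wk₀ S) ys ∷ []) (S∙ ys)
    translatedBody⊢S p pcs nomFree premise =
      convHyp body≐ (castHyp (sym (subst-⋁ Θ (map (transDisj p') pcs))) (⋁L _ disjunct))
      where
        disjunction : Tm (ext pargs (T ∷ [])) o
        disjunction = ⋁ (map (transDisj p') pcs)
        body≐ : bApp (translate p p' pcs) (wk₀ S) ys ≐ subst Θ disjunction
        body≐ =
          ≐trans (apps-≐ˡ ys (≐trans (≐β _ _)
                   (≡⇒≐ (trans (subst-rename (sub₀ (wk₀ S)) (liftR (λ ())) (lams pargs disjunction))
                               (subst-cong (λ { here → refl ; (there ()) }) (lams pargs disjunction))))))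
                 (apps-lams-β pargs P↦S disjunction ys)
        disjunct : ∀ {F} → F ∈ map (subst Θ) (map (transDisj p') pcs) → Seq D Y (F ∷ []) (S∙ ys)
        disjunct F∈ with ∈-map⁻ (subst Θ) F∈
        ... | _ , G∈ , refl with ∈-map⁻ (transDisj p') G∈
        ... | pclause xs zs ts B , pc∈ , refl =
          disjunct⊢S (premise-closed (premise pc∈))
          where open PatternClause xs zs ts B (proj₁ (nomFree pc∈)) (proj₂ (nomFree pc∈))

open InductionOnPatterns using (translatedBody⊢S)

theorem5 : (Sig : Signature) → let open Signature Sig in let open Logic Sig in
    (pargs : List ITy) (p p' : K (pargs ⇛ o)) (pcs : List (PClause pargs))
    (D : List Clause) (lv : ∀ {τ} → K τ → ℕ) →
    WFDefs D lv →
    All (PClauseOK lv p) pcs →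
    translate p p' pcs ∈ D →
    p ≢ p' →
    (∀ {c} → c ∈ D →
    ¬ (_≡_ {A = Σ (List ITy) (λ as → K (as ⇛ o))} (args c , pred c) (pargs , p'))) →
    (∀ {c} → c ∈ D → c ≢ translate p p' pcs → KFree p' (body c)) →
    (∀ {pc} → pc ∈ pcs → KFree p' (B pc) × ArgsKFree p' (ts pc)) →
    (S : Tm [] (pargs ⇛ o)) → NomFree S →
    (∀ {pc} → pc ∈ pcs → ILpPremise D S pc) →
    ∀ (Σ' : List ITy) (Γ : List (Form Σ')) (C : Form Σ') (ss : TmArgs ⌜ Σ' ⌝ˢ pargs) →
    Seq D Σ' (apps (wk₀ S) ss ∷ Γ) C →
    Seq D Σ' (apps (con p) ss ∷ Γ) C
theorem5 Sig pargs p p' pcs D lv _ ok translate∈D _ _ _ _ S S-nomFree premise Σ' Γ C ss d =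
  IL (translate p p' pcs) translate∈D refl S S-nomFree ss
     (translatedBody⊢S Sig D pargs p' S S-nomFree p pcs
        (λ pc∈ → let ok' = All.lookup ok pc∈ in PClauseOK.BnoNoms ok' , PClauseOK.tsNoNoms ok')
        premise)
     d
  where open Logic Sig
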